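{- Let $G$ be a theta-free and prism-free graph and let $\Sigma$ be a pyramid in $G$ with apex $a$, base $\{b_1,b_2,b_3\}$ and paths $P_1,P_2,P_3$. Let $u,v\in V(G)\setminus N[Z(\Sigma)]$ belong to distinct paths of $\Sigma$. Then $N[Z(\Sigma)]$ separates $u$ and $v$ in $G$.
   Context: Graphs are finite and simple. A path in $G$ is an induced subgraph that is a path; a hole is an induced cycle of length at least four. A theta is a graph consisting of two non-adjacent vertices and three pairwise internally disjoint paths between them, each of length at least two, with pairwise anticomplete interiors. A prism is a graph consisting of two triangles $\{a_1,a_2,a_3\}$, $\{b_1,b_2,b_3\}$ and three pairwise disjoint paths $P_1,P_2,P_3$, where $P_i$ has ends $a_i,b_i$ (length zero allowed), such that for distinct $i,j$ the only edges between $P_i$ and $P_j$ are $a_ia_j$ and $b_ib_j$, and $P_i\cup P_j$ induces a hole. Theta-free/prism-free means no induced subgraph isomorphic to a theta/prism. A pyramid is a graph consisting of a vertex $a$ (apex), a triangle $\{b_1,b_2,b_3\}$ (base) not containing $a$, and three paths $P_1,P_2,P_3$ of length at least one, $P_i$ having ends $a$ and $b_i$, such that for distinct $i,j$ the sets $V(P_i)\setminus\{a\}$ and $V(P_j)\setminus\{a\}$ are disjoint, $b_ib_j$ is the only edge between them, and $P_i\cup P_j$ induces a hole. A pyramid in $G$ is an induced subgraph that is a pyramid. $Z(\Sigma)=N_\Sigma[a]\cup\{b_1,b_2,b_3\}$, where $N_\Sigma[a]$ is $a$ together with its neighbors in $\Sigma$. For $X\subseteq V(G)$, $N[X]$ is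 $X$ together with all vertices of $G$ having a neighbor in $X$. A separation of $G$ is a triple $(L,M,R)$ of pairwise disjoint sets with union $V(G)$, $L,R$ non-empty and no edges between $L$ and $R$; $M\subseteq V(G)\setminus\{x,y\}$ separates $x$ and $y$ if there is a separation $(L,M,R)$ with $x\in L$, $y\in R$. -}

module Defs where

open import Data.Nat using (ℕ; zero; suc; _+_; _≤_; _%_)
open import Data.Fin using (Fin; toℕ; fromℕ) renaming (zero to fzero; suc to fsuc)
open import Data.Bool using (Bool; true; false)
open import Data.Product using (Σ; ∃; _×_; _,_)
open import Data.Sum using (_⊎_)
open import Data.Empty using (⊥)
open import Relation.Nullary using (¬_)
open import Relation.Binary.PropositionalEquality using (_≡_; _≢_)
open import Function.Definitions using (Injective)
open import Function.Bundles using (_⇔_)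

record Graph : Set where
  field
    n     : ℕ
    adj   : Fin n → Fin n → Bool
    sym   : ∀ x y → adj x y ≡ adj y x
    irrefl : ∀ x → adj x x ≡ false

module _ (G : Graph) where
  open Graph G

  V : Set
  V = Fin n

  Adj : V → V → Set
  Adj x y = adj x y ≡ true

  Consec : ℕ → ℕ → Set
  Consec i j = (j ≡ suc i) ⊎ (i ≡ suc j)

  -- A path in G: an induced subgraph that is a path, given as an injective
  -- sequence v₀ … v_len of vertices with vᵢ vⱼ adjacent iff |i-j| = 1.
  record Path : Set where
    field
      len    : ℕ
      vtx    : Fin (suc len) → V
      inj    : Injective _≡_ _≡_ vtx
      induced : ∀ i j → Adj (vtx i) (vtx j) ⇔ Consec (toℕ i) (toℕ j)

  open Path public using (len)

  start : Path → V
  start P = Path.vtx P fzero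

  end : Path → V
  end P = Path.vtx P (fromℕ (len P))

  _∈P_ : V → Path → Set
  x ∈P P = ∃ λ i → Path.vtx P i ≡ x

  Interior : Path → V → Set
  Interior P x = x ∈P P × x ≢ start P × x ≢ end P

  -- A hole in G: an induced cycle of length at least four, given as an
  -- injective cyclic sequence c₀ … c_{k-1}, k = 4 + m, with cᵢ cⱼ adjacent
  -- iff i, j are cyclically consecutive.
  record Hole : Set where
    field
      m      : ℕ
      vtx    : Fin (4 + m) → V
      inj    : Injective _≡_ _≡_ vtx
      induced : ∀ i j → Adj (vtx i) (vtx j) ⇔
                  ((toℕ j ≡ (suc (toℕ i)) % (4 + m)) ⊎ (toℕ i ≡ (suc (toℕ j)) % (4 + m)))

  InducesHole : (V → Set) → Set
  InducesHole S = Σ Hole λ H → ∀ x → ((∃ λ i → Hole.vtx H i ≡ x) ⇔ S x)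

  -- Theta: non-adjacent s, t and three paths between them, each of length
  -- at least two, pairwise internally disjoint, with pairwise anticomplete
  -- interiors.  (Such a configuration of induced paths induces exactly a theta.)
  record Theta : Set where
    field
      s t    : V
      s≁t    : ¬ Adj s t
      P      : Fin 3 → Path
      starts : ∀ i → start (P i) ≡ s
      ends   : ∀ i → end (P i) ≡ t
      long   : ∀ i → 2 ≤ len (P i)
      disj   : ∀ i j → i ≢ j → ∀ x → Interior (P i) x → ¬ (x ∈P P j)
      anti   : ∀ i j → i ≢ j → ∀ x y → Interior (P i) x → Interior (P j) y → ¬ Adj x y

  ThetaFree : Set
  ThetaFree = ¬ Theta

  record Prism : Set where
    field
      a b    : Fin 3 → V
      triA   : ∀ i j → i ≢ j → Adj (a i) (a j)
      triB   : ∀ i j → i ≢ j → Adj (b i) (b j)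
      P      : Fin 3 → Path
      starts : ∀ i → start (P i) ≡ a i
      ends   : ∀ i → end (P i) ≡ b i
      disj   : ∀ i j → i ≢ j → ∀ x → x ∈P P i → ¬ (x ∈P P j)
      edges  : ∀ i j → i ≢ j → ∀ x y → x ∈P P i → y ∈P P j → Adj x y →
                 (x ≡ a i × y ≡ a j) ⊎ (x ≡ b i × y ≡ b j)
      holes  : ∀ i j → i ≢ j → InducesHole (λ x → x ∈P P i ⊎ x ∈P P j)

  PrismFree : Set
  PrismFree = ¬ Prism

  record Pyramid : Set where
    field
      a      : V
      b      : Fin 3 → V
      tri    : ∀ i j → i ≢ j → Adj (b i) (b j)
      a∉base : ∀ i → a ≢ b i
      P      : Fin 3 → Path
      starts : ∀ i → start (P i) ≡ a
      ends   : ∀ i → end (P i) ≡ b i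
      long   : ∀ i → 1 ≤ len (P i)
      disj   : ∀ i j → i ≢ j → ∀ x → x ∈P P i → x ≢ a → ¬ (x ∈P P j)
      edges  : ∀ i j → i ≢ j → ∀ x y → x ∈P P i → x ≢ a → y ∈P P j → y ≢ a →
                 Adj x y → x ≡ b i × y ≡ b j
      holes  : ∀ i j → i ≢ j → InducesHole (λ x → x ∈P P i ⊎ x ∈P P j)

    InΣ : V → Set
    InΣ x = ∃ λ i → x ∈P P i

    Z : V → Set
    Z x = (x ≡ a) ⊎ (InΣ x × Adj a x) ⊎ (∃ λ i → x ≡ b i)

    NZ : V → Set
    NZ x = ∃ λ z → Z z × (x ≡ z ⊎ Adj x z)

  record Separation : Set₁ where
    field
      L M R  : V → Set
      LM     : ∀ x → L x → ¬ M x
      LR     : ∀ x → L x → ¬ R x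
      MR     : ∀ x → M x → ¬ R x
      cover  : ∀ x → L x ⊎ M x ⊎ R x
      L≠∅    : ∃ L
      R≠∅    : ∃ R
      noEdge : ∀ x y → L x → R y → ¬ Adj x y

  Separates : (V → Set) → V → V → Set₁
  Separates M x y = Σ Separation λ S →
    (∀ z → Separation.M S z ⇔ M z) × Separation.L S x × Separation.R S y

{-# OPTIONS --safe #-}
-- Let C be the component of u in G − N[Z(Σ)].  A vertex of P_i outside N[Z(Σ)] has all its
-- neighbours in Σ on P_i, so every vertex of C lies on P_i or is reached from P_i by a walk
-- avoiding Σ ∪ N[Z(Σ)]; if v ∈ C, some such walk runs from a vertex attached to P_i to one
-- attached to P_j.  A shortest one is an induced path Q attached to Σ only at its ends, or a
-- single vertex attached to all three paths, which closes a theta with the apex.  Attachments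
-- of vertices outside N[Z(Σ)] avoid the apex, its neighbours and the base, so according as an
-- end of Q sees two non-consecutive vertices of its path, exactly two consecutive ones, or
-- (at both ends) a single one, Q and Σ contain a theta, a prism, or a theta.
module Submission where

open import Data.Bool using (true)
import Data.Bool as B
open import Data.Empty using (⊥; ⊥-elim)
open import Data.Fin using (Fin; toℕ; fromℕ; fromℕ<) renaming (zero to fz; suc to fs)
import Data.Fin.Properties as FP
open import Data.Fin.Subset using (Subset; _⊆_; ∣_∣) renaming (_∈_ to _∈ₛ_)
open import Data.Fin.Subset.Properties using (p⊂q⇒∣p∣<∣q∣; ∣p∣≤n)
open import Data.List using (List; []; _∷_; _++_; reverse; length; [_]; lookup)
import Data.List.Properties as LP
open import Data.List.Membership.Propositional using (_∈_; find; lose)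
open import Data.List.Membership.Propositional.Properties using (∈-++⁻; ∈-++⁺ˡ; ∈-++⁺ʳ; ∈-∃++; ∈-lookup)
open import Data.List.Relation.Unary.Any using (here; there; any?; index)
import Data.List.Relation.Unary.Any.Properties as AnyP
open import Data.List.Relation.Unary.All using (All)
import Data.List.Relation.Unary.All as All
import Data.List.Relation.Unary.All.Properties as AllP
open import Data.Nat using (ℕ; zero; suc; _+_; _∸_; _≤_; _<_; z≤n; s≤s; _≤?_; _%_)
open import Data.Nat.DivMod using (m≤n⇒m%n≡m; n%n≡0)
open import Data.Nat.Properties
open import Data.Product using (∃; _×_; _,_; proj₁; proj₂)
open import Data.Sum using (_⊎_; inj₁; inj₂)
open import Data.Unit using (⊤; tt)
import Data.Vec as Vec
import Data.Vec.Properties as VecP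
open import Function.Base using (id; _∘_)
open import Function.Bundles using (_⇔_; mk⇔; Equivalence)
open import Relation.Binary.PropositionalEquality using (_≡_; _≢_; refl; sym; trans; cong; cong₂; subst; subst₂)
open import Relation.Nullary using (¬_; Dec; yes; no; ¬?)
open import Relation.Nullary.Decidable using (_⊎-dec_; _×-dec_; _→-dec_; does; map′; dec-true)

open import Defs

module _ (P : ℕ → Set) (P? : ∀ r → Dec (P r)) where

  least-witness : ∀ r₀ → P r₀ → ∃ λ m → P m × m ≤ r₀ × (∀ r → r < m → ¬ P r)
  least-witness r₀ pr₀ = search 0 r₀ (λ _ ()) refl
    where
    search : ∀ k d → (∀ r → r < k → ¬ P r) → k + d ≡ r₀ →
             ∃ λ m → P m × m ≤ r₀ × (∀ r → r < m → ¬ P r)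
    search k d below e with P? k
    ... | yes pk = k , pk , subst (k ≤_) e (m≤m+n k d) , below
    search k zero below e | no ¬pk = ⊥-elim (¬pk (subst P (trans (sym e) (+-identityʳ k)) pr₀))
    search k (suc d) below e | no ¬pk = search (suc k) d below′ (trans (sym (+-suc k d)) e)
      where
      below′ : ∀ r → r < suc k → ¬ P r
      below′ r r<1+k with m≤n⇒m<n∨m≡n (≤-pred r<1+k)
      ... | inj₁ r<k = below r r<k
      ... | inj₂ refl = ¬pk

  greatest-witness : ∀ N r₀ → P r₀ → r₀ ≤ N →
                     ∃ λ m → P m × r₀ ≤ m × m ≤ N × (∀ r → m < r → r ≤ N → ¬ P r)
  greatest-witness N r₀ pr₀ r₀≤N = search N (λ r N<r r≤N → ⊥-elim (<⇒≱ N<r r≤N)) r₀≤N ≤-refl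
    where
    search : ∀ k → (∀ r → k < r → r ≤ N → ¬ P r) → r₀ ≤ k → k ≤ N →
             ∃ λ m → P m × r₀ ≤ m × m ≤ N × (∀ r → m < r → r ≤ N → ¬ P r)
    search k above r₀≤k k≤N with P? k
    ... | yes pk = k , pk , r₀≤k , k≤N , above
    search zero above z≤n k≤N | no ¬pk = ⊥-elim (¬pk pr₀)
    search (suc k) above r₀≤k k≤N | no ¬pk with m≤n⇒m<n∨m≡n r₀≤k
    ... | inj₂ refl = ⊥-elim (¬pk pr₀)
    ... | inj₁ r₀<1+k = search k above′ (≤-pred r₀<1+k) (≤-trans (n≤1+n k) k≤N)
      where
      above′ : ∀ r → k < r → r ≤ N → ¬ P r
      above′ r k<r r≤N with m≤n⇒m<n∨m≡n k<r
      ... | inj₁ 1+k<r = above r 1+k<r r≤N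
      ... | inj₂ refl = ¬pk

  any≤? : ∀ N → Dec (∃ λ r → r ≤ N × P r)
  any≤? N = map′ (λ (r , r<1+N , pr) → r , ≤-pred r<1+N , pr) (λ (r , r≤N , pr) → r , s≤s r≤N , pr)
                 (anyUpTo? P? (suc N))

module _ {P : ℕ → Set} where

  ≤-least⇒≡ : ∀ {m r} → (∀ r′ → r′ < m → ¬ P r′) → r ≤ m → P r → r ≡ m
  ≤-least⇒≡ none-below r≤m pr with m≤n⇒m<n∨m≡n r≤m
  ... | inj₁ r<m = ⊥-elim (none-below _ r<m pr)
  ... | inj₂ r≡m = r≡m

  ≥-greatest⇒≡ : ∀ {m r N} → (∀ r′ → m < r′ → r′ ≤ N → ¬ P r′) → m ≤ r → r ≤ N → P r → r ≡ m
  ≥-greatest⇒≡ none-above m≤r r≤N pr with m≤n⇒m<n∨m≡n m≤r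
  ... | inj₁ m<r = ⊥-elim (none-above _ m<r r≤N pr)
  ... | inj₂ m≡r = sym m≡r

  unique-witness : ∀ {m N} → (∀ r′ → r′ < m → ¬ P r′) → (∀ r′ → m < r′ → r′ ≤ N → ¬ P r′) →
                   ∀ r → r ≤ N → P r → r ≡ m
  unique-witness {m} none-below none-above r r≤N pr with r ≤? m
  ... | yes r≤m = ≤-least⇒≡ none-below r≤m pr
  ... | no r≰m = ⊥-elim (none-above r (≰⇒> r≰m) r≤N pr)

gap-cases : ∀ {a b} → a ≤ b → a ≡ b ⊎ b ≡ suc a ⊎ 2 + a ≤ b
gap-cases a≤b with m≤n⇒m<n∨m≡n a≤b
... | inj₂ a≡b = inj₁ a≡b
... | inj₁ a<b with m≤n⇒m<n∨m≡n a<b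
...   | inj₂ 1+a≡b = inj₂ (inj₁ (sym 1+a≡b))
...   | inj₁ 1+a<b = inj₂ (inj₂ 1+a<b)

module _ (R : Fin 3 → Fin 3 → Set) (R-sym : ∀ {c d} → R c d → R d c) where

  Fin3-pairwise : R fz (fs fz) → R fz (fs (fs fz)) → R (fs fz) (fs (fs fz)) → ∀ c d → c ≢ d → R c d
  Fin3-pairwise r₀₁ r₀₂ r₁₂ fz fz c≢d = ⊥-elim (c≢d refl)
  Fin3-pairwise r₀₁ r₀₂ r₁₂ fz (fs fz) _ = r₀₁
  Fin3-pairwise r₀₁ r₀₂ r₁₂ fz (fs (fs fz)) _ = r₀₂
  Fin3-pairwise r₀₁ r₀₂ r₁₂ (fs fz) fz _ = R-sym r₀₁
  Fin3-pairwise r₀₁ r₀₂ r₁₂ (fs fz) (fs fz) c≢d = ⊥-elim (c≢d refl)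
  Fin3-pairwise r₀₁ r₀₂ r₁₂ (fs fz) (fs (fs fz)) _ = r₁₂
  Fin3-pairwise r₀₁ r₀₂ r₁₂ (fs (fs fz)) fz _ = R-sym r₀₂
  Fin3-pairwise r₀₁ r₀₂ r₁₂ (fs (fs fz)) (fs fz) _ = R-sym r₁₂
  Fin3-pairwise r₀₁ r₀₂ r₁₂ (fs (fs fz)) (fs (fs fz)) c≢d = ⊥-elim (c≢d refl)

third : ∀ (i j : Fin 3) → i ≢ j → ∃ λ k → i ≢ k × j ≢ k × (∀ c → c ≡ i ⊎ c ≡ j ⊎ c ≡ k)
third fz fz i≢j = ⊥-elim (i≢j refl)
third fz (fs fz) _ = fs (fs fz) , (λ ()) , (λ ()) , λ { fz → inj₁ refl ; (fs fz) → inj₂ (inj₁ refl) ; (fs (fs fz)) → inj₂ (inj₂ refl) }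
third fz (fs (fs fz)) _ = fs fz , (λ ()) , (λ ()) , λ { fz → inj₁ refl ; (fs fz) → inj₂ (inj₂ refl) ; (fs (fs fz)) → inj₂ (inj₁ refl) }
third (fs fz) fz _ = fs (fs fz) , (λ ()) , (λ ()) , λ { fz → inj₂ (inj₁ refl) ; (fs fz) → inj₁ refl ; (fs (fs fz)) → inj₂ (inj₂ refl) }
third (fs fz) (fs fz) i≢j = ⊥-elim (i≢j refl)
third (fs fz) (fs (fs fz)) _ = fz , (λ ()) , (λ ()) , λ { fz → inj₂ (inj₂ refl) ; (fs fz) → inj₁ refl ; (fs (fs fz)) → inj₂ (inj₁ refl) }
third (fs (fs fz)) fz _ = fs fz , (λ ()) , (λ ()) , λ { fz → inj₂ (inj₁ refl) ; (fs fz) → inj₂ (inj₂ refl) ; (fs (fs fz)) → inj₁ refl }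
third (fs (fs fz)) (fs fz) _ = fz , (λ ()) , (λ ()) , λ { fz → inj₂ (inj₂ refl) ; (fs fz) → inj₂ (inj₁ refl) ; (fs (fs fz)) → inj₁ refl }
third (fs (fs fz)) (fs (fs fz)) i≢j = ⊥-elim (i≢j refl)

module InducedLists (G : Graph) where
  Vertex : Set
  Vertex = V G

  _~_ : Vertex → Vertex → Set
  x ~ y = Adj G x y

  ~-sym : ∀ {x y} → x ~ y → y ~ x
  ~-sym {x} {y} e = trans (Graph.sym G y x) e

  ~-irrefl : ∀ {x} → x ~ x → ⊥
  ~-irrefl {x} e with trans (sym (Graph.irrefl G x)) e
  ... | ()

  consec-sym : ∀ {i j} → Consec G i j → Consec G j i
  consec-sym (inj₁ e) = inj₂ e
  consec-sym (inj₂ e) = inj₁ e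

  consec-suc : ∀ {i j} → Consec G i j → Consec G (suc i) (suc j)
  consec-suc (inj₁ e) = inj₁ (cong suc e)
  consec-suc (inj₂ e) = inj₂ (cong suc e)

  consec-pred : ∀ {i j} → Consec G (suc i) (suc j) → Consec G i j
  consec-pred (inj₁ e) = inj₁ (suc-injective e)
  consec-pred (inj₂ e) = inj₂ (suc-injective e)

  adjacent? : ∀ x y → Dec (x ~ y)
  adjacent? x y = Graph.adj G x y B.≟ true

  Apart : Vertex → List Vertex → Set
  Apart x ys = All (λ y → x ≢ y × ¬ x ~ y) ys

  Induced : List Vertex → Set
  Induced [] = ⊤
  Induced (x ∷ []) = ⊤
  Induced (x ∷ y ∷ ys) = x ~ y × Apart x ys × Induced (y ∷ ys)

  data HeadOf : List Vertex → Vertex → Set where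
    first : ∀ {x xs} → HeadOf (x ∷ xs) x

  data LastOf : List Vertex → Vertex → Set where
    last-[] : ∀ {x} → LastOf (x ∷ []) x
    last-∷ : ∀ {x y ys z} → LastOf (y ∷ ys) z → LastOf (x ∷ y ∷ ys) z

  lastVertex : Vertex → List Vertex → Vertex
  lastVertex x [] = x
  lastVertex x (y ∷ ys) = lastVertex y ys

  lastVertex-LastOf : ∀ x xs → LastOf (x ∷ xs) (lastVertex x xs)
  lastVertex-LastOf x [] = last-[]
  lastVertex-LastOf x (y ∷ ys) = last-∷ (lastVertex-LastOf y ys)

  LastOf-unique : ∀ {xs y z} → LastOf xs y → LastOf xs z → y ≡ z
  LastOf-unique last-[] last-[] = refl
  LastOf-unique (last-∷ p) (last-∷ q) = LastOf-unique p q

  LastOf-∈ : ∀ {xs y} → LastOf xs y → y ∈ xs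
  LastOf-∈ last-[] = here refl
  LastOf-∈ (last-∷ p) = there (LastOf-∈ p)

  LastOf-++ : ∀ xs {ys y} → LastOf ys y → LastOf (xs ++ ys) y
  LastOf-++ [] p = p
  LastOf-++ (x ∷ []) last-[] = last-∷ last-[]
  LastOf-++ (x ∷ []) (last-∷ p) = last-∷ (last-∷ p)
  LastOf-++ (x ∷ x' ∷ xs) p = last-∷ (LastOf-++ (x' ∷ xs) p)

  HeadOf-++ : ∀ {xs} ys {y} → HeadOf xs y → HeadOf (xs ++ ys) y
  HeadOf-++ ys first = first

  subst-LastOf : ∀ {l l' y} → l ≡ l' → LastOf l y → LastOf l' y
  subst-LastOf refl p = p

  HeadOf⇒LastOf-reverse : ∀ {xs y} → HeadOf xs y → LastOf (reverse xs) y
  HeadOf⇒LastOf-reverse {x ∷ xs} first = subst-LastOf (sym (LP.unfold-reverse x xs)) (LastOf-++ (reverse xs) last-[])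

  LastOf-reverse⇒HeadOf : ∀ {xs y} → LastOf (reverse xs) y → HeadOf xs y
  LastOf-reverse⇒HeadOf {x ∷ xs} {y} p with LastOf-unique (LastOf-++ (reverse xs) (last-[] {x})) (subst-LastOf (LP.unfold-reverse x xs) p)
  ... | refl = first

  LastOf⇒HeadOf-reverse : ∀ {xs y} → LastOf xs y → HeadOf (reverse xs) y
  LastOf⇒HeadOf-reverse {xs} {y} p = LastOf-reverse⇒HeadOf (subst-LastOf (sym (LP.reverse-involutive xs)) p)

  HeadOf-reverse⇒LastOf : ∀ {xs y} → HeadOf (reverse xs) y → LastOf xs y
  HeadOf-reverse⇒LastOf {xs} {y} p = subst-LastOf (LP.reverse-involutive xs) (HeadOf⇒LastOf-reverse p)

  Induced-tail : ∀ x xs → Induced (x ∷ xs) → Induced xs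
  Induced-tail x [] _ = tt
  Induced-tail x (y ∷ ys) (_ , _ , p) = p

  Induced-head∉tail : ∀ x xs → Induced (x ∷ xs) → x ∈ xs → ⊥
  Induced-head∉tail x (y ∷ ys) (e , an , _) (here refl) = ~-irrefl e
  Induced-head∉tail x (y ∷ ys) (e , an , _) (there m) = proj₁ (All.lookup an m) refl

  Induced-head-neighbour : ∀ x xs → Induced (x ∷ xs) → ∀ {z} → z ∈ xs → x ~ z → HeadOf xs z
  Induced-head-neighbour x (y ∷ ys) _ (here refl) e = first
  Induced-head-neighbour x (y ∷ ys) (_ , an , _) (there m) e = ⊥-elim (proj₂ (All.lookup an m) e)

  Induced-head-last⇒singleton : ∀ x xs → Induced (x ∷ xs) → LastOf (x ∷ xs) x → xs ≡ []
  Induced-head-last⇒singleton x [] _ _ = refl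
  Induced-head-last⇒singleton x (y ∷ ys) ip (last-∷ p) = ⊥-elim (Induced-head∉tail x (y ∷ ys) ip (LastOf-∈ p))

  Induced-head~next : ∀ x xs → Induced (x ∷ xs) → ∀ {z} → HeadOf xs z → x ~ z
  Induced-head~next x (y ∷ ys) ip first = proj₁ ip

  HeadOf-∷ : ∀ {x xs y} → HeadOf (x ∷ xs) y → x ≡ y
  HeadOf-∷ first = refl

  HeadOf⇒≡∷ : ∀ {xs y} → HeadOf xs y → ∃ λ ys → xs ≡ y ∷ ys
  HeadOf⇒≡∷ first = _ , refl

  LastOf-tail : ∀ {x y ys z} → LastOf (x ∷ y ∷ ys) z → LastOf (y ∷ ys) z
  LastOf-tail (last-∷ p) = p

  MeetOnlyAtSeam : List Vertex → List Vertex → Set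
  MeetOnlyAtSeam as bs = ∀ {x y} → x ∈ as → y ∈ bs → x ≢ y × (x ~ y → LastOf as x × HeadOf bs y)

  SeamAdjacent : List Vertex → List Vertex → Set
  SeamAdjacent as bs = ∀ {x y} → LastOf as x → HeadOf bs y → x ~ y

  Induced-++ : ∀ as bs → Induced as → Induced bs → SeamAdjacent as bs → MeetOnlyAtSeam as bs → Induced (as ++ bs)
  Induced-++ [] bs _ ib _ _ = ib
  Induced-++ (x ∷ []) [] _ _ _ _ = tt
  Induced-++ (x ∷ []) (y ∷ ys) _ ib seam meet = seam last-[] first , All.tabulate x-apart-ys , ib
    where
    x-apart-ys : ∀ {z} → z ∈ ys → x ≢ z × ¬ x ~ z
    x-apart-ys z∈ys = proj₁ (meet (here refl) (there z∈ys)) ,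
      λ x~z → Induced-head∉tail y ys ib (subst (_∈ ys) (sym (HeadOf-∷ (proj₂ (proj₂ (meet (here refl) (there z∈ys)) x~z)))) z∈ys)
  Induced-++ (x ∷ x′ ∷ xs) bs (x~x′ , x-apart-xs , ip) ib seam meet =
    x~x′ , AllP.++⁺ x-apart-xs (All.tabulate x-apart-bs) , Induced-++ (x′ ∷ xs) bs ip ib seam′ meet′
    where
    x-apart-bs : ∀ {z} → z ∈ bs → x ≢ z × ¬ x ~ z
    x-apart-bs z∈bs = proj₁ (meet (here refl) z∈bs) ,
      λ x~z → Induced-head∉tail x (x′ ∷ xs) (x~x′ , x-apart-xs , ip) (LastOf-∈ (LastOf-tail (proj₁ (proj₂ (meet (here refl) z∈bs) x~z))))
    seam′ : SeamAdjacent (x′ ∷ xs) bs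
    seam′ l h = seam (last-∷ l) h
    meet′ : MeetOnlyAtSeam (x′ ∷ xs) bs
    meet′ y∈ z∈ = Data.Product.map₂ (λ at-seam y~z → Data.Product.map₁ LastOf-tail (at-seam y~z)) (meet (there y∈) z∈)

  Induced-reverse : ∀ xs → Induced xs → Induced (reverse xs)
  Induced-reverse [] _ = tt
  Induced-reverse (x ∷ xs) ip = subst Induced (sym (LP.unfold-reverse x xs)) (
    Induced-++ (reverse xs) [ x ] (Induced-reverse xs (Induced-tail x xs ip)) tt seam meet)
    where
    seam : SeamAdjacent (reverse xs) [ x ]
    seam {z} {y} p first = ~-sym (Induced-head~next x xs ip (LastOf-reverse⇒HeadOf p))
    meet : MeetOnlyAtSeam (reverse xs) [ x ]
    meet {z} {y} m (here refl) =
      (λ eq → Induced-head∉tail x xs ip (subst (_∈ xs) eq (AnyP.reverse⁻ m))) ,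
      (λ e → HeadOf⇒LastOf-reverse (Induced-head-neighbour x xs ip (AnyP.reverse⁻ m) (~-sym e)) , first)

  LastOf-≡ : ∀ {X x y} → LastOf X x → x ≡ y → LastOf X y
  LastOf-≡ l refl = l

  HeadOf-≡ : ∀ {X x y} → HeadOf X x → x ≡ y → HeadOf X y
  HeadOf-≡ h refl = h

  Induced-∷ : ∀ x X → Induced X → (∀ {y} → HeadOf X y → x ~ y) → (∀ {y} → y ∈ X → x ≢ y × (x ~ y → HeadOf X y)) → Induced (x ∷ X)
  Induced-∷ x X ip h c = Induced-++ [ x ] X tt ip (λ { last-[] hy → h hy }) (λ { (here refl) m → proj₁ (c m) , λ e → last-[] , proj₂ (c m) e })

  weaken-apart : ∀ {A : Set} {x y} → x ≢ y × ¬ x ~ y → x ≢ y × (x ~ y → A)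
  weaken-apart (x≢y , x≁y) = x≢y , ⊥-elim ∘ x≁y

  apart-sym : ∀ {x y : Vertex} → x ≢ y × ¬ x ~ y → y ≢ x × ¬ y ~ x
  apart-sym (a1 , a2) = (λ e → a1 (sym e)) , (λ e → a2 (~-sym e))

  ∈⇒lookup : ∀ {xs : List Vertex} {z} → z ∈ xs → ∃ λ i → lookup xs i ≡ z
  ∈⇒lookup z∈xs = index z∈xs , sym (AnyP.lookup-index z∈xs)

  lookup-last : ∀ x xs → LastOf (x ∷ xs) (lookup (x ∷ xs) (fromℕ (length xs)))
  lookup-last x [] = last-[]
  lookup-last x (y ∷ ys) = last-∷ (lookup-last y ys)

  lookup-adj₀⇒consec : ∀ x xs → Induced (x ∷ xs) → ∀ j → x ~ lookup (x ∷ xs) j → Consec G 0 (toℕ j)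
  lookup-adj₀⇒consec x xs ip fz e = ⊥-elim (~-irrefl e)
  lookup-adj₀⇒consec x (y ∷ ys) ip (fs fz) e = inj₁ refl
  lookup-adj₀⇒consec x (y ∷ y′ ∷ ys) (_ , apart , _) (fs (fs j)) e = ⊥-elim (proj₂ (All.lookup apart (∈-lookup j)) e)

  lookup-adj⇒consec : ∀ x xs → Induced (x ∷ xs) → ∀ i j → lookup (x ∷ xs) i ~ lookup (x ∷ xs) j → Consec G (toℕ i) (toℕ j)
  lookup-adj⇒consec x xs ip fz j e = lookup-adj₀⇒consec x xs ip j e
  lookup-adj⇒consec x (y ∷ ys) ip (fs i) fz e = consec-sym (lookup-adj₀⇒consec x (y ∷ ys) ip (fs i) (~-sym e))
  lookup-adj⇒consec x (y ∷ ys) ip (fs i) (fs j) e = consec-suc (lookup-adj⇒consec y ys (Induced-tail x (y ∷ ys) ip) i j e)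

  consec₀⇒lookup-adj : ∀ x xs → Induced (x ∷ xs) → ∀ j → Consec G 0 (toℕ j) → x ~ lookup (x ∷ xs) j
  consec₀⇒lookup-adj x (y ∷ ys) ip (fs fz) c = proj₁ ip
  consec₀⇒lookup-adj x (y ∷ ys) ip (fs (fs j)) (inj₁ ())
  consec₀⇒lookup-adj x (y ∷ ys) ip (fs j) (inj₂ ())
  consec₀⇒lookup-adj x xs ip fz (inj₁ ())
  consec₀⇒lookup-adj x xs ip fz (inj₂ ())

  consec⇒lookup-adj : ∀ x xs → Induced (x ∷ xs) → ∀ i j → Consec G (toℕ i) (toℕ j) → lookup (x ∷ xs) i ~ lookup (x ∷ xs) j
  consec⇒lookup-adj x xs ip fz j c = consec₀⇒lookup-adj x xs ip j c
  consec⇒lookup-adj x (y ∷ ys) ip (fs i) fz c = ~-sym (consec₀⇒lookup-adj x (y ∷ ys) ip (fs i) (consec-sym c))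
  consec⇒lookup-adj x (y ∷ ys) ip (fs i) (fs j) c = consec⇒lookup-adj y ys (Induced-tail x (y ∷ ys) ip) i j (consec-pred c)

  lookup-injective : ∀ x xs → Induced (x ∷ xs) → ∀ i j → lookup (x ∷ xs) i ≡ lookup (x ∷ xs) j → i ≡ j
  lookup-injective x xs ip fz fz e = refl
  lookup-injective x (y ∷ ys) ip fz (fs j) e = ⊥-elim (Induced-head∉tail x (y ∷ ys) ip (subst (_∈ (y ∷ ys)) (sym e) (∈-lookup j)))
  lookup-injective x (y ∷ ys) ip (fs i) fz e = ⊥-elim (Induced-head∉tail x (y ∷ ys) ip (subst (_∈ (y ∷ ys)) e (∈-lookup i)))
  lookup-injective x (y ∷ ys) ip (fs i) (fs j) e = cong fs (lookup-injective y ys (Induced-tail x (y ∷ ys) ip) i j e)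

  toPath : (x : Vertex) (xs : List Vertex) → Induced (x ∷ xs) → Path G
  toPath x xs ip = record
    { len = length xs
    ; vtx = lookup (x ∷ xs)
    ; inj = λ {i} {j} e → lookup-injective x xs ip i j e
    ; induced = λ i j → mk⇔ (lookup-adj⇒consec x xs ip i j) (consec⇒lookup-adj x xs ip i j) }

  ∈toPath⇒∈ : ∀ x xs ip {z} → _∈P_ G z (toPath x xs ip) → z ∈ (x ∷ xs)
  ∈toPath⇒∈ x xs ip (i , refl) = ∈-lookup i

  ∈⇒∈toPath : ∀ x xs ip {z} → z ∈ (x ∷ xs) → _∈P_ G z (toPath x xs ip)
  ∈⇒∈toPath x xs ip = ∈⇒lookup

  toPath-end : ∀ x xs ip → LastOf (x ∷ xs) (end G (toPath x xs ip))
  toPath-end x xs ip = lookup-last x xs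

  LastOf-∷ : ∀ {x ys u} → LastOf ys u → LastOf (x ∷ ys) u
  LastOf-∷ last-[] = last-∷ last-[]
  LastOf-∷ (last-∷ p) = last-∷ (last-∷ p)

  CyclicConsec : ℕ → ℕ → ℕ → Set
  CyclicConsec K a b = Consec G a b ⊎ (a ≡ 0 × b ≡ K) ⊎ (a ≡ K × b ≡ 0)

  -- The adjacency of Defs.Hole on a cycle of length suc K.
  ModConsec : ℕ → ℕ → ℕ → Set
  ModConsec K a b = (b ≡ suc a % suc K) ⊎ (a ≡ suc b % suc K)

  suc-mod : ∀ K a → a ≤ K → (suc a ≤ K × suc a % suc K ≡ suc a) ⊎ (a ≡ K × suc a % suc K ≡ 0)
  suc-mod K a le with m≤n⇒m<n∨m≡n le
  ... | inj₁ lt = inj₁ (lt , m≤n⇒m%n≡m lt)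
  ... | inj₂ refl = inj₂ (refl , n%n≡0 (suc K))

  CyclicConsec⇒ModConsec : ∀ K a b → a ≤ K → b ≤ K → CyclicConsec K a b → ModConsec K a b
  CyclicConsec⇒ModConsec K a b la lb (inj₁ (inj₁ refl)) with suc-mod K a la
  ... | inj₁ (_ , e) = inj₁ (sym e)
  ... | inj₂ (refl , _) = ⊥-elim (1+n≰n lb)
  CyclicConsec⇒ModConsec K a b la lb (inj₁ (inj₂ refl)) with suc-mod K b lb
  ... | inj₁ (_ , e) = inj₂ (sym e)
  ... | inj₂ (refl , _) = ⊥-elim (1+n≰n la)
  CyclicConsec⇒ModConsec K a b la lb (inj₂ (inj₁ (refl , refl))) = inj₂ (sym (n%n≡0 (suc K)))
  CyclicConsec⇒ModConsec K a b la lb (inj₂ (inj₂ (refl , refl))) = inj₁ (sym (n%n≡0 (suc K)))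

  ModConsec⇒CyclicConsec : ∀ K a b → a ≤ K → b ≤ K → ModConsec K a b → CyclicConsec K a b
  ModConsec⇒CyclicConsec K a b la lb (inj₁ e) with suc-mod K a la
  ... | inj₁ (_ , e') = inj₁ (inj₁ (trans e e'))
  ... | inj₂ (refl , e') = inj₂ (inj₂ (refl , trans e e'))
  ModConsec⇒CyclicConsec K a b la lb (inj₂ e) with suc-mod K b lb
  ... | inj₁ (_ , e') = inj₁ (inj₂ (trans e e'))
  ... | inj₂ (refl , e') = inj₂ (inj₁ (trans e e' , refl))

  record ClosesCycle (z : Vertex) (ws : List Vertex) : Set where
    field
      path-induced : Induced ws
      z∉path : z ∈ ws → ⊥
      z~head : ∀ {w} → HeadOf ws w → z ~ w
      z~last : ∀ {w} → LastOf ws w → z ~ w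
      z-adj⇒end : ∀ {w} → w ∈ ws → z ~ w → HeadOf ws w ⊎ LastOf ws w

  module ClosedCycle (z w1 : Vertex) (ws : List Vertex) (cd : ClosesCycle z (w1 ∷ ws)) where
    open ClosesCycle cd

    K : ℕ
    K = suc (length ws)

    z-adj⇒end-index : ∀ j → z ~ lookup (w1 ∷ ws) j → toℕ j ≡ 0 ⊎ toℕ j ≡ length ws
    z-adj⇒end-index j e with z-adj⇒end (∈-lookup j) e
    ... | inj₁ h = inj₁ (cong toℕ (lookup-injective w1 ws path-induced j fz (sym (HeadOf-∷ h))))
    ... | inj₂ l = inj₂ (trans (cong toℕ (lookup-injective w1 ws path-induced j (fromℕ (length ws)) (LastOf-unique l (lookup-last w1 ws)))) (FP.toℕ-fromℕ (length ws)))

    end-index⇒z-adj : ∀ j → toℕ j ≡ 0 ⊎ toℕ j ≡ length ws → z ~ lookup (w1 ∷ ws) j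
    end-index⇒z-adj j (inj₁ e) with FP.toℕ-injective {i = j} {j = fz} e
    ... | refl = z~head first
    end-index⇒z-adj j (inj₂ e) with FP.toℕ-injective {i = j} {j = fromℕ (length ws)} (trans e (sym (FP.toℕ-fromℕ (length ws))))
    ... | refl = z~last (lookup-last w1 ws)

    adj⇒cyclic-consec : ∀ i j → lookup (z ∷ w1 ∷ ws) i ~ lookup (z ∷ w1 ∷ ws) j → CyclicConsec K (toℕ i) (toℕ j)
    adj⇒cyclic-consec fz fz e = ⊥-elim (~-irrefl e)
    adj⇒cyclic-consec fz (fs j) e with z-adj⇒end-index j e
    ... | inj₁ q = inj₁ (inj₁ (cong suc q))
    ... | inj₂ q = inj₂ (inj₁ (refl , cong suc q))
    adj⇒cyclic-consec (fs i) fz e with z-adj⇒end-index i (~-sym e)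
    ... | inj₁ q = inj₁ (inj₂ (cong suc q))
    ... | inj₂ q = inj₂ (inj₂ (cong suc q , refl))
    adj⇒cyclic-consec (fs i) (fs j) e = inj₁ (consec-suc (lookup-adj⇒consec w1 ws path-induced i j e))

    cyclic-consec⇒adj : ∀ i j → CyclicConsec K (toℕ i) (toℕ j) → lookup (z ∷ w1 ∷ ws) i ~ lookup (z ∷ w1 ∷ ws) j
    cyclic-consec⇒adj fz fz (inj₁ (inj₁ ()))
    cyclic-consec⇒adj fz fz (inj₁ (inj₂ ()))
    cyclic-consec⇒adj fz fz (inj₂ (inj₁ (_ , ())))
    cyclic-consec⇒adj fz fz (inj₂ (inj₂ (() , _)))
    cyclic-consec⇒adj fz (fs j) (inj₁ (inj₁ q)) = end-index⇒z-adj j (inj₁ (suc-injective q))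
    cyclic-consec⇒adj fz (fs j) (inj₁ (inj₂ ()))
    cyclic-consec⇒adj fz (fs j) (inj₂ (inj₁ (_ , q))) = end-index⇒z-adj j (inj₂ (suc-injective q))
    cyclic-consec⇒adj fz (fs j) (inj₂ (inj₂ (() , _)))
    cyclic-consec⇒adj (fs i) fz (inj₁ (inj₁ ()))
    cyclic-consec⇒adj (fs i) fz (inj₁ (inj₂ q)) = ~-sym (end-index⇒z-adj i (inj₁ (suc-injective q)))
    cyclic-consec⇒adj (fs i) fz (inj₂ (inj₁ (() , _)))
    cyclic-consec⇒adj (fs i) fz (inj₂ (inj₂ (q , _))) = ~-sym (end-index⇒z-adj i (inj₂ (suc-injective q)))
    cyclic-consec⇒adj (fs i) (fs j) (inj₁ c) = consec⇒lookup-adj w1 ws path-induced i j (consec-pred c)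
    cyclic-consec⇒adj (fs i) (fs j) (inj₂ (inj₁ (() , _)))
    cyclic-consec⇒adj (fs i) (fs j) (inj₂ (inj₂ (_ , ())))

    cycle-injective : ∀ i j → lookup (z ∷ w1 ∷ ws) i ≡ lookup (z ∷ w1 ∷ ws) j → i ≡ j
    cycle-injective fz fz e = refl
    cycle-injective fz (fs j) e = ⊥-elim (z∉path (subst (_∈ (w1 ∷ ws)) (sym e) (∈-lookup j)))
    cycle-injective (fs i) fz e = ⊥-elim (z∉path (subst (_∈ (w1 ∷ ws)) e (∈-lookup i)))
    cycle-injective (fs i) (fs j) e = cong fs (lookup-injective w1 ws path-induced i j e)

    adj⇔mod-consec : ∀ i j → (lookup (z ∷ w1 ∷ ws) i ~ lookup (z ∷ w1 ∷ ws) j) ⇔ ModConsec K (toℕ i) (toℕ j)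
    adj⇔mod-consec i j = mk⇔ (λ e → CyclicConsec⇒ModConsec K _ _ (FP.toℕ≤pred[n] i) (FP.toℕ≤pred[n] j) (adj⇒cyclic-consec i j e))
                   (λ c → cyclic-consec⇒adj i j (ModConsec⇒CyclicConsec K _ _ (FP.toℕ≤pred[n] i) (FP.toℕ≤pred[n] j) c))

  cycleHole : (z w1 w2 w3 : Vertex) (rest : List Vertex) → ClosesCycle z (w1 ∷ w2 ∷ w3 ∷ rest) → Hole G
  cycleHole z w1 w2 w3 rest cd = record
    { m = length rest
    ; vtx = lookup (z ∷ w1 ∷ w2 ∷ w3 ∷ rest)
    ; inj = λ {i} {j} e → ClosedCycle.cycle-injective z w1 (w2 ∷ w3 ∷ rest) cd i j e
    ; induced = ClosedCycle.adj⇔mod-consec z w1 (w2 ∷ w3 ∷ rest) cd }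

  inducesHole : (z : Vertex) (ws : List Vertex) → 3 ≤ length ws → ClosesCycle z ws → (S : Vertex → Set) →
           (∀ x → x ∈ (z ∷ ws) → S x) → (∀ x → S x → x ∈ (z ∷ ws)) → InducesHole G S
  inducesHole z (w1 ∷ []) (s≤s ()) cd S f g
  inducesHole z (w1 ∷ w2 ∷ []) (s≤s (s≤s ())) cd S f g
  inducesHole z (w1 ∷ w2 ∷ w3 ∷ rest) _ cd S f g =
    cycleHole z w1 w2 w3 rest cd ,
    λ x → mk⇔ (λ { (i , refl) → f _ (∈-lookup i) }) (λ s → ∈⇒lookup (g x s))

  ApartOutside : Vertex → List Vertex → List Vertex → Set
  ApartOutside t X Y = ∀ {x y} → x ∈ X → x ≢ t → y ∈ Y → y ≢ t → x ≢ y × ¬ x ~ y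

  ApartOutside-sym : ∀ {t X Y} → ApartOutside t X Y → ApartOutside t Y X
  ApartOutside-sym s m1 n1 m2 n2 = (λ e → proj₁ (s m2 n2 m1 n1) (sym e)) , (λ e → proj₂ (s m2 n2 m1 n1) (~-sym e))

  theta : (s t : Vertex) → ¬ s ~ t → (tl : Fin 3 → List Vertex) → (ip : ∀ i → Induced (s ∷ tl i)) →
            (∀ i → LastOf (s ∷ tl i) t) → (∀ i → 2 ≤ length (tl i)) →
            (∀ i j → i ≢ j → ApartOutside t (tl i) (tl j)) → Theta G
  theta s t s≁t tl ip lst lng sep = record
    { s = s ; t = t ; s≁t = s≁t
    ; P = λ i → toPath s (tl i) (ip i)
    ; starts = λ i → refl
    ; ends = λ i → LastOf-unique (toPath-end s (tl i) (ip i)) (lst i)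
    ; long = lng
    ; disj = disjoint
    ; anti = anticomplete }
    where
    ends-at-t : ∀ i → end G (toPath s (tl i) (ip i)) ≡ t
    ends-at-t i = LastOf-unique (toPath-end s (tl i) (ip i)) (lst i)
    interior⇒∈tail : ∀ i x → Interior G (toPath s (tl i) (ip i)) x → x ∈ tl i × x ≢ t
    interior⇒∈tail i x (m , ns , ne) with ∈toPath⇒∈ s (tl i) (ip i) m
    ... | here e = ⊥-elim (ns e)
    ... | there m' = m' , λ e → ne (trans e (sym (ends-at-t i)))
    disjoint : ∀ i j → i ≢ j → ∀ x → Interior G (toPath s (tl i) (ip i)) x → ¬ (_∈P_ G x (toPath s (tl j) (ip j)))
    disjoint i j ij x int m with interior⇒∈tail i x int | ∈toPath⇒∈ s (tl j) (ip j) m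
    ... | _ | here e = proj₁ (proj₂ int) e
    ... | (m1 , n1) | there m2 = proj₁ (sep i j ij m1 n1 m2 n1) refl
    anticomplete : ∀ i j → i ≢ j → ∀ x y → Interior G (toPath s (tl i) (ip i)) x → Interior G (toPath s (tl j) (ip j)) y → ¬ (x ~ y)
    anticomplete i j ij x y ix iy with interior⇒∈tail i x ix | interior⇒∈tail j y iy
    ... | (m1 , n1) | (m2 , n2) = proj₂ (sep i j ij m1 n1 m2 n2)

  AtSameEnds : List Vertex → List Vertex → Vertex → Vertex → Set
  AtSameEnds X Y x y = (HeadOf X x × HeadOf Y y) ⊎ (LastOf X x × LastOf Y y)

  JoinedAtEnds : List Vertex → List Vertex → Set
  JoinedAtEnds X Y = ∀ {x y} → x ∈ X → y ∈ Y → x ≢ y × (x ~ y → AtSameEnds X Y x y)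

  JoinedAtEnds-sym : ∀ {X Y} → JoinedAtEnds X Y → JoinedAtEnds Y X
  JoinedAtEnds-sym p m1 m2 = (λ e → proj₁ (p m2 m1) (sym e)) ,
    (λ e → Data.Sum.map Data.Product.swap Data.Product.swap (proj₂ (p m2 m1) (~-sym e)))

  rungs-close-cycle : ∀ (x y : Vertex) (ys : List Vertex) (x2 : Vertex) (xs2 : List Vertex) → Induced (x ∷ y ∷ ys) → Induced (x2 ∷ xs2) →
             JoinedAtEnds (x ∷ y ∷ ys) (x2 ∷ xs2) → x ~ x2 →
             (∀ {u w} → LastOf (x ∷ y ∷ ys) u → LastOf (x2 ∷ xs2) w → u ~ w) →
             ClosesCycle x ((y ∷ ys) ++ reverse (x2 ∷ xs2))
  rungs-close-cycle x y ys x2 xs2 ip ip2 joined heads~ lasts~ = record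
    { path-induced = Induced-++ (y ∷ ys) (reverse (x2 ∷ xs2)) (Induced-tail x (y ∷ ys) ip) (Induced-reverse (x2 ∷ xs2) ip2) seam meet
    ; z∉path = x∉cycle
    ; z~head = λ { first → proj₁ ip }
    ; z~last = λ l → subst (x ~_) (LastOf-unique (LastOf-++ (y ∷ ys) (HeadOf⇒LastOf-reverse (first {x2} {xs2}))) l) heads~
    ; z-adj⇒end = z-adj⇒end }
    where
    seam : SeamAdjacent (y ∷ ys) (reverse (x2 ∷ xs2))
    seam lu hw = lasts~ (last-∷ lu) (HeadOf-reverse⇒LastOf hw)
    meet : MeetOnlyAtSeam (y ∷ ys) (reverse (x2 ∷ xs2))
    meet {u} {w} mu mw with joined (there mu) (AnyP.reverse⁻ mw)
    ... | u≢w , edge-at-ends = u≢w , λ u~w → at-lasts (edge-at-ends u~w)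
      where
      at-lasts : AtSameEnds (x ∷ y ∷ ys) (x2 ∷ xs2) u w →
                 LastOf (y ∷ ys) u × HeadOf (reverse (x2 ∷ xs2)) w
      at-lasts (inj₁ (u-head , _)) = ⊥-elim (Induced-head∉tail x (y ∷ ys) ip (subst (_∈ (y ∷ ys)) (sym (HeadOf-∷ u-head)) mu))
      at-lasts (inj₂ (u-last , w-last)) = LastOf-tail u-last , LastOf⇒HeadOf-reverse w-last
    x∉cycle : x ∈ ((y ∷ ys) ++ reverse (x2 ∷ xs2)) → ⊥
    x∉cycle m with ∈-++⁻ (y ∷ ys) m
    ... | inj₁ m' = Induced-head∉tail x (y ∷ ys) ip m'
    ... | inj₂ m' = proj₁ (joined (here refl) (AnyP.reverse⁻ m')) refl
    z-adj⇒end : ∀ {w} → w ∈ ((y ∷ ys) ++ reverse (x2 ∷ xs2)) → x ~ w →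
         HeadOf ((y ∷ ys) ++ reverse (x2 ∷ xs2)) w ⊎ LastOf ((y ∷ ys) ++ reverse (x2 ∷ xs2)) w
    z-adj⇒end m e with ∈-++⁻ (y ∷ ys) m
    ... | inj₁ m' = inj₁ (HeadOf-++ (reverse (x2 ∷ xs2)) (Induced-head-neighbour x (y ∷ ys) ip m' e))
    ... | inj₂ m' with proj₂ (joined (here refl) (AnyP.reverse⁻ m')) e
    ... | inj₁ (_ , hw) = inj₂ (LastOf-++ (y ∷ ys) (HeadOf⇒LastOf-reverse hw))
    ... | inj₂ (lx , _) with Induced-head-last⇒singleton x (y ∷ ys) ip lx
    ... | ()

  prism : (h : Fin 3 → Vertex) (ts : Fin 3 → List Vertex) (ip : ∀ i → Induced (h i ∷ ts i)) (nonempty : ∀ i → 1 ≤ length (ts i))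
            (joined : ∀ i j → i ≢ j → JoinedAtEnds (h i ∷ ts i) (h j ∷ ts j))
            (heads~ : ∀ i j → i ≢ j → h i ~ h j) (lasts~ : ∀ i j → i ≢ j → lastVertex (h i) (ts i) ~ lastVertex (h j) (ts j)) → Prism G
  prism h ts ip nonempty joined heads~ lasts~ = record
    { a = h
    ; b = λ i → lastVertex (h i) (ts i)
    ; triA = heads~
    ; triB = lasts~
    ; P = P
    ; starts = λ i → refl
    ; ends = λ i → ends-at-last i
    ; disj = λ i j ij x m1 m2 → proj₁ (joined i j ij (∈toPath⇒∈ (h i) (ts i) (ip i) m1) (∈toPath⇒∈ (h j) (ts j) (ip j) m2)) refl
    ; edges = edges′
    ; holes = holes′ }
    where
    P : Fin 3 → Path G
    P i = toPath (h i) (ts i) (ip i)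
    ends-at-last : ∀ i → end G (P i) ≡ lastVertex (h i) (ts i)
    ends-at-last i = LastOf-unique (toPath-end (h i) (ts i) (ip i)) (lastVertex-LastOf (h i) (ts i))
    edges′ : ∀ i j → i ≢ j → ∀ x y → _∈P_ G x (P i) → _∈P_ G y (P j) → x ~ y →
          (x ≡ h i × y ≡ h j) ⊎ (x ≡ lastVertex (h i) (ts i) × y ≡ lastVertex (h j) (ts j))
    edges′ i j ij x y m1 m2 e with proj₂ (joined i j ij (∈toPath⇒∈ (h i) (ts i) (ip i) m1) (∈toPath⇒∈ (h j) (ts j) (ip j) m2)) e
    ... | inj₁ (h1 , h2) = inj₁ (sym (HeadOf-∷ h1) , sym (HeadOf-∷ h2))
    ... | inj₂ (l1' , l2') = inj₂ (LastOf-unique l1' (lastVertex-LastOf (h i) (ts i)) , LastOf-unique l2' (lastVertex-LastOf (h j) (ts j)))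
    hole : ∀ i j → i ≢ j → ∀ y ys → ts i ≡ y ∷ ys → InducesHole G (λ x → _∈P_ G x (P i) ⊎ _∈P_ G x (P j))
    hole i j ij y ys eq = inducesHole (h i) ((y ∷ ys) ++ reverse (h j ∷ ts j)) long-enough
      (rungs-close-cycle (h i) y ys (h j) (ts j) (subst (λ l → Induced (h i ∷ l)) eq (ip i)) (ip j)
        (subst (λ l → JoinedAtEnds (h i ∷ l) (h j ∷ ts j)) eq (joined i j ij)) (heads~ i j ij)
        (λ {u} {w} lu lw → subst₂ _~_ (sym (LastOf-unique (subst (λ l → LastOf (h i ∷ l) u) (sym eq) lu) (lastVertex-LastOf (h i) (ts i))))
                                      (sym (LastOf-unique lw (lastVertex-LastOf (h j) (ts j)))) (lasts~ i j ij)))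
      _ ∈cycle⇒∈paths ∈paths⇒∈cycle
      where
      long-enough : 3 ≤ length ((y ∷ ys) ++ reverse (h j ∷ ts j))
      long-enough rewrite LP.length-++ (y ∷ ys) {reverse (h j ∷ ts j)} | LP.length-reverse (h j ∷ ts j) =
        s≤s (≤-trans (s≤s (nonempty j)) (m≤n+m (suc (length (ts j))) (length ys)))
      ∈cycle⇒∈paths : ∀ x → x ∈ (h i ∷ (y ∷ ys) ++ reverse (h j ∷ ts j)) → _∈P_ G x (P i) ⊎ _∈P_ G x (P j)
      ∈cycle⇒∈paths x (here refl) = inj₁ (fz , refl)
      ∈cycle⇒∈paths x (there m) with ∈-++⁻ (y ∷ ys) m
      ... | inj₁ m' = inj₁ (∈⇒∈toPath (h i) (ts i) (ip i) (there (subst (x ∈_) (sym eq) m')))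
      ... | inj₂ m' = inj₂ (∈⇒∈toPath (h j) (ts j) (ip j) (AnyP.reverse⁻ m'))
      ∈paths⇒∈cycle : ∀ x → _∈P_ G x (P i) ⊎ _∈P_ G x (P j) → x ∈ (h i ∷ (y ∷ ys) ++ reverse (h j ∷ ts j))
      ∈paths⇒∈cycle x (inj₁ m) with ∈toPath⇒∈ (h i) (ts i) (ip i) m
      ... | here e = here e
      ... | there m' = there (∈-++⁺ˡ (subst (x ∈_) eq m'))
      ∈paths⇒∈cycle x (inj₂ m) = there (∈-++⁺ʳ (y ∷ ys) (AnyP.reverse⁺ (∈toPath⇒∈ (h j) (ts j) (ip j) m)))
    holes′ : ∀ i j → i ≢ j → InducesHole G (λ x → _∈P_ G x (P i) ⊎ _∈P_ G x (P j))
    holes′ i j ij = hole-nonempty (ts i) refl (nonempty i)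
      where
      hole-nonempty : (l : List Vertex) → ts i ≡ l → 1 ≤ length l → InducesHole G (λ x → _∈P_ G x (P i) ⊎ _∈P_ G x (P j))
      hole-nonempty (y ∷ ys) eq _ = hole i j ij y ys eq

  IsWalk : List Vertex → Set
  IsWalk [] = ⊤
  IsWalk (x ∷ []) = ⊤
  IsWalk (x ∷ y ∷ ys) = x ~ y × IsWalk (y ∷ ys)

  IsWalk-suffix : ∀ as z vs → IsWalk (as ++ z ∷ vs) → IsWalk (z ∷ vs)
  IsWalk-suffix [] z vs l = l
  IsWalk-suffix (a ∷ []) z vs (_ , l) = l
  IsWalk-suffix (a ∷ a' ∷ as) z vs (_ , l) = IsWalk-suffix (a' ∷ as) z vs l

  IsWalk-prefix : ∀ as z vs → IsWalk (as ++ z ∷ vs) → IsWalk (as ++ [ z ])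
  IsWalk-prefix [] z vs l = tt
  IsWalk-prefix (a ∷ []) z vs (e , _) = e , tt
  IsWalk-prefix (a ∷ a' ∷ as) z vs (e , l) = e , IsWalk-prefix (a' ∷ as) z vs l

  lastVertex-++ : ∀ x us z vs → lastVertex x (us ++ z ∷ vs) ≡ lastVertex z vs
  lastVertex-++ x [] z vs = refl
  lastVertex-++ x (u ∷ us) z vs = lastVertex-++ u us z vs

  Shortcut : Vertex → List Vertex → Set
  Shortcut x xs = ∃ λ xs' → length xs' < length xs × IsWalk (x ∷ xs') × lastVertex x xs' ≡ lastVertex x xs × (∀ {y} → y ∈ (x ∷ xs') → y ∈ (x ∷ xs))

  shortcut-or-induced : ∀ x xs → IsWalk (x ∷ xs) → Induced (x ∷ xs) ⊎ Shortcut x xs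
  shortcut-or-induced x [] _ = inj₁ tt
  shortcut-or-induced x (y ∷ ys) (e , l) with shortcut-or-induced y ys l
  ... | inj₂ (ys' , lt , l' , le , sub) = inj₂ (y ∷ ys' , s≤s lt , (e , l') , le , sub')
    where
    sub' : ∀ {z} → z ∈ (x ∷ y ∷ ys') → z ∈ (x ∷ y ∷ ys)
    sub' (here eq) = here eq
    sub' (there m) = there (sub m)
  ... | inj₁ ipy with any? (λ z → FP._≟_ x z ⊎-dec adjacent? x z) ys
  ...   | no na = inj₁ (e , All.tabulate (λ m → (λ eq → na (lose m (inj₁ eq))) , (λ a → na (lose m (inj₂ a)))) , ipy)
  ...   | yes an = inj₂ (cut (find an))
    where
    cut : (∃ λ z → z ∈ ys × (x ≡ z ⊎ x ~ z)) → Shortcut x (y ∷ ys)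
    cut (z , zm , pz) with ∈-∃++ zm
    ... | us , vs , refl = cut2 pz
      where
      cut2 : (x ≡ z ⊎ x ~ z) → Shortcut x (y ∷ us ++ z ∷ vs)
      cut2 (inj₁ refl) = vs , s≤s (≤-trans (n≤1+n _) (LP.length-++-≤ʳ (x ∷ vs) {us})) , IsWalk-suffix (y ∷ us) x vs l ,
        sym (lastVertex-++ y us x vs) , λ { (here eq) → here eq ; (there m) → there (there (∈-++⁺ʳ us (there m))) }
      cut2 (inj₂ a) = z ∷ vs , s≤s (LP.length-++-≤ʳ (z ∷ vs) {us}) , (a , IsWalk-suffix (y ∷ us) z vs l) ,
        sym (lastVertex-++ y us z vs) , λ { (here eq) → here eq ; (there m) → there (there (∈-++⁺ʳ us m)) }

  length-prefix< : ∀ (us : List Vertex) y v vs → length (us ++ [ y ]) < length (us ++ y ∷ v ∷ vs)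
  length-prefix< [] y v vs = s≤s (s≤s z≤n)
  length-prefix< (u ∷ us) y v vs = s≤s (length-prefix< us y v vs)

  ∈-prefix : ∀ (x : Vertex) us y vs {w} → w ∈ (x ∷ us ++ [ y ]) → w ∈ (x ∷ us ++ y ∷ vs)
  ∈-prefix x us y vs (here e) = here e
  ∈-prefix x us y vs (there m) with ∈-++⁻ us m
  ... | inj₁ m' = there (∈-++⁺ˡ m')
  ... | inj₂ (here e) = there (∈-++⁺ʳ us (here e))

  IsWalk-snoc : ∀ x xs y → IsWalk (x ∷ xs) → lastVertex x xs ~ y → IsWalk (x ∷ xs ++ [ y ])
  IsWalk-snoc x [] y _ e = e , tt
  IsWalk-snoc x (x′ ∷ xs) y (e′ , w) e = e′ , IsWalk-snoc x′ xs y w e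

module _ {n : ℕ} (R : ℕ → Fin n → Set) (R? : ∀ k x → Dec (R k x))
         (R-mono : ∀ k x → R k x → R (suc k) x) where

  private
    subset : ℕ → Subset n
    subset k = Vec.tabulate (λ x → does (R? k x))

    ∈subset⁺ : ∀ {k x} → R k x → x ∈ₛ subset k
    ∈subset⁺ {k} {x} r = VecP.lookup⇒[]= x (subset k) (trans (VecP.lookup∘tabulate _ x) (dec-true (R? k x) r))

    ∈subset⁻ : ∀ {k x} → x ∈ₛ subset k → R k x
    ∈subset⁻ {k} {x} x∈ with R? k x | trans (sym (VecP.lookup∘tabulate _ x)) (VecP.[]=⇒lookup x∈)
    ... | yes r | _ = r
    ... | no _ | ()

    Stable : ℕ → Set
    Stable k = ∀ x → R (suc k) x → R k x

    stable-or-grown : ∀ k → (∃ Stable) ⊎ (k ≤ ∣ subset k ∣)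
    stable-or-grown zero = inj₂ z≤n
    stable-or-grown (suc k) with stable-or-grown k
    ... | inj₁ st = inj₁ st
    ... | inj₂ k≤∣Rk∣ with FP.all? (λ x → R? (suc k) x →-dec R? k x)
    ...   | yes st = inj₁ (k , st)
    ...   | no ¬st with FP.¬∀⟶∃¬ _ _ (λ x → R? (suc k) x →-dec R? k x) ¬st
    ...     | x , new with R? (suc k) x | R? k x
    ...       | _ | yes old = ⊥-elim (new (λ _ → old))
    ...       | no ¬now | no _ = ⊥-elim (new (λ now → ⊥-elim (¬now now)))
    ...       | yes now | no ¬old = inj₂ (≤-trans (s≤s k≤∣Rk∣) (p⊂q⇒∣p∣<∣q∣ (Rk⊆Rk+1 , x , ∈subset⁺ now , ¬old ∘ ∈subset⁻)))
      where
      Rk⊆Rk+1 : subset k ⊆ subset (suc k)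
      Rk⊆Rk+1 = ∈subset⁺ ∘ R-mono k _ ∘ ∈subset⁻

  iteration-stabilises : ∃ λ k → ∀ x → R (suc k) x → R k x
  iteration-stabilises with stable-or-grown (suc n)
  ... | inj₁ st = st
  ... | inj₂ n<∣R∣ = ⊥-elim (<⇒≱ n<∣R∣ (∣p∣≤n (subset (suc n))))

closed-set-separates : (G : Graph) (M C : V G → Set) → (∀ x → Dec (M x)) → (∀ x → Dec (C x)) →
                       (∀ x → C x → ¬ M x) → (∀ x y → C x → ¬ M y → Adj G x y → C y) →
                       ∀ {u v} → C u → ¬ M v → ¬ C v → Separates G M u v
closed-set-separates G M C M? C? C∩M=∅ C-closed {u} {v} Cu ¬Mv ¬Cv =
  record
    { L = C
    ; M = M
    ; R = Rest
    ; LM = C∩M=∅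
    ; LR = λ _ Cx (_ , ¬Cx) → ¬Cx Cx
    ; MR = λ _ Mx (¬Mx , _) → ¬Mx Mx
    ; cover = cover
    ; L≠∅ = u , Cu
    ; R≠∅ = v , ¬Mv , ¬Cv
    ; noEdge = λ x y Cx (¬My , ¬Cy) x~y → ¬Cy (C-closed x y Cx ¬My x~y)
    } , (λ _ → mk⇔ id id) , Cu , (¬Mv , ¬Cv)
  where
  Rest : V G → Set
  Rest x = ¬ M x × ¬ C x

  cover : ∀ x → C x ⊎ M x ⊎ Rest x
  cover x with C? x | M? x
  ... | yes Cx | _ = inj₁ Cx
  ... | no ¬Cx | yes Mx = inj₂ (inj₁ Mx)
  ... | no ¬Cx | no ¬Mx = inj₂ (inj₂ (¬Mx , ¬Cx))

module PyramidGeometry (G : Graph) (S : Pyramid G) where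
  open InducedLists G
  module Py = Pyramid S

  apex : Vertex
  apex = Py.a

  L : Fin 3 → ℕ
  L c = Path.len (Py.P c)

  -- p c r is the r-th vertex of P_c counted from the apex; indices r > L c give the apex.
  position : (c : Fin 3) → ℕ → Fin (suc (L c))
  position c r with r ≤? L c
  ... | yes le = fromℕ< (s≤s le)
  ... | no _ = fz

  p : Fin 3 → ℕ → Vertex
  p c r = Path.vtx (Py.P c) (position c r)

  toℕ-position : ∀ c r → r ≤ L c → toℕ (position c r) ≡ r
  toℕ-position c r le with r ≤? L c
  ... | yes le' = FP.toℕ-fromℕ< (s≤s le')
  ... | no nle = ⊥-elim (nle le)

  position-toℕ : ∀ c (i : Fin (suc (L c))) → position c (toℕ i) ≡ i
  position-toℕ c i = FP.toℕ-injective (toℕ-position c (toℕ i) (FP.toℕ≤pred[n] i))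

  p-∈P : ∀ c r → r ≤ L c → _∈P_ G (p c r) (Py.P c)
  p-∈P c r le = position c r , refl

  ∈P⇒p : ∀ c {x} → _∈P_ G x (Py.P c) → ∃ λ r → r ≤ L c × p c r ≡ x
  ∈P⇒p c (i , e) = toℕ i , FP.toℕ≤pred[n] i , trans (cong (Path.vtx (Py.P c)) (position-toℕ c i)) e

  p-apex : ∀ c → p c 0 ≡ apex
  p-apex c = trans (cong (Path.vtx (Py.P c)) (FP.toℕ-injective {i = position c 0} {j = fz} (toℕ-position c 0 z≤n))) (Py.starts c)

  p-base : ∀ c → p c (L c) ≡ Py.b c
  p-base c = trans (cong (Path.vtx (Py.P c)) (FP.toℕ-injective {i = position c (L c)} {j = fromℕ (L c)}
           (trans (toℕ-position c (L c) ≤-refl) (sym (FP.toℕ-fromℕ (L c)))))) (Py.ends c)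

  p-adj⇒consec : ∀ c {r r'} → r ≤ L c → r' ≤ L c → p c r ~ p c r' → Consec G r r'
  p-adj⇒consec c {r} {r'} le le' e = subst₂ (Consec G) (toℕ-position c r le) (toℕ-position c r' le')
    (Equivalence.to (Path.induced (Py.P c) (position c r) (position c r')) e)

  p-adj-suc : ∀ c {r} → suc r ≤ L c → p c r ~ p c (suc r)
  p-adj-suc c {r} le = Equivalence.from (Path.induced (Py.P c) (position c r) (position c (suc r)))
    (inj₁ (trans (toℕ-position c (suc r) le) (cong suc (sym (toℕ-position c r (≤-trans (n≤1+n r) le))))))

  p-injective : ∀ c {r r'} → r ≤ L c → r' ≤ L c → p c r ≡ p c r' → r ≡ r'
  p-injective c {r} {r'} le le' e = trans (sym (toℕ-position c r le)) (trans (cong toℕ (Path.inj (Py.P c) e)) (toℕ-position c r' le'))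

  L≥1 : ∀ c → 1 ≤ L c
  L≥1 c = Py.long c

  p≢apex : ∀ c {r} → 1 ≤ r → r ≤ L c → p c r ≢ apex
  p≢apex c {r} h le e with p-injective c le z≤n (trans e (sym (p-apex c)))
  p≢apex c {suc r} h le e | ()

  p-disjoint : ∀ c d → c ≢ d → ∀ {r r'} → 1 ≤ r → r ≤ L c → r' ≤ L d → p c r ≢ p d r'
  p-disjoint c d cd {r} h le le' e = Py.disj c d cd (p c r) (p-∈P c r le) (p≢apex c h le) (subst (λ x → _∈P_ G x (Py.P d)) (sym e) (p-∈P d _ le'))

  p-cross-edge⇒bases : ∀ c d → c ≢ d → ∀ {r r'} → 1 ≤ r → r ≤ L c → 1 ≤ r' → r' ≤ L d → p c r ~ p d r' → r ≡ L c × r' ≡ L d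
  p-cross-edge⇒bases c d cd {r} {r'} h le h' le' e with Py.edges c d cd (p c r) (p d r') (p-∈P c r le) (p≢apex c h le) (p-∈P d r' le') (p≢apex d h' le') e
  ... | e1 , e2 = p-injective c le ≤-refl (trans e1 (sym (p-base c))) , p-injective d le' ≤-refl (trans e2 (sym (p-base d)))

  apex-adj⇒1 : ∀ c {r} → r ≤ L c → apex ~ p c r → r ≡ 1
  apex-adj⇒1 c {r} le e with p-adj⇒consec c z≤n le (subst (_~ p c r) (sym (p-apex c)) e)
  ... | inj₁ q = q
  ... | inj₂ ()

  apex~p1 : ∀ c → apex ~ p c 1
  apex~p1 c = subst (_~ p c 1) (p-apex c) (p-adj-suc c (L≥1 c))

  base~base : ∀ c d → c ≢ d → p c (L c) ~ p d (L d)
  base~base c d cd = subst₂ _~_ (sym (p-base c)) (sym (p-base d)) (Py.tri c d cd)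

  NZ : Vertex → Set
  NZ = Py.NZ

  Outside : Vertex → Set
  Outside x = ¬ NZ x × ¬ Py.InΣ x

  ¬NZ⇒≁apex : ∀ {x} → ¬ NZ x → ¬ x ~ apex
  ¬NZ⇒≁apex nz e = nz (apex , inj₁ refl , inj₂ e)

  ¬NZ⇒≢apex : ∀ {x} → ¬ NZ x → x ≢ apex
  ¬NZ⇒≢apex nz e = nz (apex , inj₁ refl , inj₁ e)

  Z-p1 : ∀ c → Py.Z (p c 1)
  Z-p1 c = inj₂ (inj₁ ((c , p-∈P c 1 (L≥1 c)) , apex~p1 c))

  Z-base : ∀ c → Py.Z (p c (L c))
  Z-base c = inj₂ (inj₂ (c , p-base c))

  ¬NZ-attachment-inner : ∀ {x} → ¬ NZ x → ∀ c {r} → r ≤ L c → x ~ p c r → 2 ≤ r × suc r ≤ L c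
  ¬NZ-attachment-inner nz c {zero} le e = ⊥-elim (¬NZ⇒≁apex nz (subst (_ ~_) (p-apex c) e))
  ¬NZ-attachment-inner nz c {suc zero} le e = ⊥-elim (nz (p c 1 , Z-p1 c , inj₂ e))
  ¬NZ-attachment-inner nz c {suc (suc r)} le e with m≤n⇒m<n∨m≡n le
  ... | inj₁ lt = s≤s (s≤s z≤n) , lt
  ... | inj₂ eq = ⊥-elim (nz (p c (L c) , Z-base c , inj₂ (subst (λ r' → _ ~ p c r') eq e)))

  ¬NZ-edge-stays-on-path : ∀ {c d r y} → r ≤ L c → ¬ NZ (p c r) → ¬ NZ y → _∈P_ G y (Py.P d) → p c r ~ y → d ≡ c
  ¬NZ-edge-stays-on-path {c} {d} {r} {y} r≤L pcr∉NZ y∉NZ y∈Pd pcr~y with d FP.≟ c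
  ... | yes d≡c = d≡c
  ... | no d≢c = ⊥-elim (pcr∉NZ (p c (L c) , Z-base c , inj₁ (trans pcr≡bc (sym (p-base c)))))
    where
    pcr≡bc : p c r ≡ Py.b c
    pcr≡bc = proj₁ (Py.edges c d (d≢c ∘ sym) (p c r) y (p-∈P c r r≤L) (¬NZ⇒≢apex pcr∉NZ) y∈Pd (¬NZ⇒≢apex y∉NZ) pcr~y)

  Outside⇒∉P : ∀ {x} → Outside x → ∀ c {r} → r ≤ L c → x ≢ p c r
  Outside⇒∉P (_ , ni) c le e = ni (c , subst (λ y → _∈P_ G y (Py.P c)) (sym e) (p-∈P c _ le))

  segUp : Fin 3 → ℕ → ℕ → List Vertex
  segUp-tail : Fin 3 → ℕ → ℕ → List Vertex
  segUp c lo n = p c lo ∷ segUp-tail c lo n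
  segUp-tail c lo zero = []
  segUp-tail c lo (suc n) = segUp c (suc lo) n

  segDown : Fin 3 → ℕ → ℕ → List Vertex
  segDown-tail : Fin 3 → ℕ → ℕ → List Vertex
  segDown c lo n = p c (lo + n) ∷ segDown-tail c lo n
  segDown-tail c lo zero = []
  segDown-tail c lo (suc n) = segDown c lo n

  OnSegment : Fin 3 → ℕ → ℕ → Vertex → Set
  OnSegment c lo hi y = ∃ λ r → lo ≤ r × r ≤ hi × p c r ≡ y

  segUp-∈ : ∀ c lo n {y} → y ∈ segUp c lo n → OnSegment c lo (lo + n) y
  segUp-∈ c lo n (here refl) = lo , ≤-refl , m≤m+n lo n , refl
  segUp-∈ c lo (suc n) (there m) with segUp-∈ c (suc lo) n m
  ... | r , a1 , a2 , e = r , ≤-trans (n≤1+n lo) a1 , subst (r ≤_) (sym (+-suc lo n)) a2 , e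

  segUp-tail-∈ : ∀ c lo n {y} → y ∈ segUp-tail c lo n → OnSegment c (suc lo) (lo + n) y
  segUp-tail-∈ c lo (suc n) m with segUp-∈ c (suc lo) n m
  ... | r , a1 , a2 , e = r , a1 , subst (r ≤_) (sym (+-suc lo n)) a2 , e

  segDown-∈ : ∀ c lo n {y} → y ∈ segDown c lo n → OnSegment c lo (lo + n) y
  segDown-∈ c lo n (here refl) = lo + n , m≤m+n lo n , ≤-refl , refl
  segDown-∈ c lo (suc n) (there m) with segDown-∈ c lo n m
  ... | r , a1 , a2 , e = r , a1 , ≤-trans a2 (subst (lo + n ≤_) (sym (+-suc lo n)) (n≤1+n _)) , e

  segDown-tail-∈ : ∀ c lo n {y} → y ∈ segDown-tail c lo n → ∃ λ r → lo ≤ r × suc r ≤ lo + n × p c r ≡ y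
  segDown-tail-∈ c lo (suc n) m with segDown-∈ c lo n m
  ... | r , a1 , a2 , e = r , a1 , subst (suc r ≤_) (sym (+-suc lo n)) (s≤s a2) , e

  segUp-last : ∀ c lo n → LastOf (segUp c lo n) (p c (lo + n))
  segUp-last c lo zero = subst (λ r → LastOf (segUp c lo zero) (p c r)) (sym (+-identityʳ lo)) last-[]
  segUp-last c lo (suc n) = subst (λ r → LastOf (segUp c lo (suc n)) (p c r)) (sym (+-suc lo n)) (last-∷ (segUp-last c (suc lo) n))

  segDown-last : ∀ c lo n → LastOf (segDown c lo n) (p c lo)
  segDown-last c lo zero = subst (λ r → LastOf (segDown c lo zero) (p c r)) (+-identityʳ lo) last-[]
  segDown-last c lo (suc n) = last-∷ (segDown-last c lo n)

  segUp-length : ∀ c lo n → length (segUp c lo n) ≡ suc n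
  segUp-length c lo zero = refl
  segUp-length c lo (suc n) = cong suc (segUp-length c (suc lo) n)

  segDown-length : ∀ c lo n → length (segDown c lo n) ≡ suc n
  segDown-length c lo zero = refl
  segDown-length c lo (suc n) = cong suc (segDown-length c lo n)

  segUp-tail-length : ∀ c lo n → length (segUp-tail c lo n) ≡ n
  segUp-tail-length c lo zero = refl
  segUp-tail-length c lo (suc n) = segUp-length c (suc lo) n

  p-far⇒apart : ∀ c {r r'} → r' ≤ L c → 2 + r ≤ r' → p c r ≢ p c r' × ¬ p c r ~ p c r'
  p-far⇒apart c {r} {r'} le' h = (λ e → 1+n≰n (≤-trans (s≤s (n≤1+n _)) (≤-trans h (≤-reflexive (sym (p-injective c rl le' e)))))) ,
    λ e → cn (p-adj⇒consec c rl le' e)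
    where
    rl : r ≤ L c
    rl = ≤-trans (≤-trans (n≤1+n r) (n≤1+n (suc r))) (≤-trans h le')
    cn : Consec G r r' → ⊥
    cn (inj₁ refl) = 1+n≰n (≤-pred h)
    cn (inj₂ refl) = 1+n≰n (≤-trans (n≤1+n _) (≤-trans (s≤s (n≤1+n _)) h))

  segUp-induced : ∀ c lo n → lo + n ≤ L c → Induced (segUp c lo n)
  segUp-induced c lo zero le = tt
  segUp-induced c lo (suc n) le =
    p-adj-suc c (≤-trans (s≤s (m≤m+n lo n)) (subst (_≤ L c) (+-suc lo n) le)) ,
    All.tabulate an , segUp-induced c (suc lo) n (subst (_≤ L c) (+-suc lo n) le)
    where
    an : ∀ {y} → y ∈ segUp-tail c (suc lo) n → p c lo ≢ y × ¬ p c lo ~ y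
    an m with segUp-tail-∈ c (suc lo) n m
    ... | r , a1 , a2 , refl = p-far⇒apart c (≤-trans a2 (subst (_≤ L c) (+-suc lo n) le)) a1

  segDown-induced : ∀ c lo n → lo + n ≤ L c → Induced (segDown c lo n)
  segDown-induced c lo zero le = tt
  segDown-induced c lo (suc n) le =
    ~-sym (subst (λ r → p c (lo + n) ~ p c r) (sym (+-suc lo n)) (p-adj-suc c (subst (_≤ L c) (+-suc lo n) le))) ,
    All.tabulate an , segDown-induced c lo n (≤-trans (n≤1+n _) (subst (_≤ L c) (+-suc lo n) le))
    where
    an : ∀ {y} → y ∈ segDown-tail c lo n → p c (lo + suc n) ≢ y × ¬ p c (lo + suc n) ~ y
    an m with segDown-tail-∈ c lo n m
    ... | r , a1 , a2 , refl = apart-sym (p-far⇒apart c le (subst (2 + r ≤_) (sym (+-suc lo n)) (s≤s a2)))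

  p≢apex⇒1≤ : ∀ c {r x} → p c r ≡ x → x ≢ apex → 1 ≤ r
  p≢apex⇒1≤ c {zero} e ne = ⊥-elim (ne (trans (sym e) (p-apex c)))
  p≢apex⇒1≤ c {suc r} e ne = s≤s z≤n

  p-apart : ∀ c d → c ≢ d → ∀ {r r'} → 1 ≤ r → suc r ≤ L c → 1 ≤ r' → r' ≤ L d → p c r ≢ p d r' × ¬ p c r ~ p d r'
  p-apart c d cd {r} {r'} h lt h' le' = p-disjoint c d cd h (≤-trans (n≤1+n r) lt) le' ,
    λ e → <⇒≢ lt (proj₁ (p-cross-edge⇒bases c d cd h (≤-trans (n≤1+n r) lt) h' le' e))

  p-apart˘ : ∀ c d → c ≢ d → ∀ {r r'} → 1 ≤ r → r ≤ L c → 1 ≤ r' → suc r' ≤ L d → p c r ≢ p d r' × ¬ p c r ~ p d r'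
  p-apart˘ c d cd h le h' lt = apart-sym (p-apart d c (λ e → cd (sym e)) h' lt h le)

  apex-apart : ∀ c {r} → 2 ≤ r → r ≤ L c → apex ≢ p c r × ¬ apex ~ p c r
  apex-apart c {r} h le = (λ e → p≢apex c (≤-trans (s≤s z≤n) h) le (sym e)) ,
    λ e → 1+n≰n (≤-trans h (≤-reflexive (apex-adj⇒1 c le e)))

  AttachedTo : Fin 3 → Vertex → Set
  AttachedTo c x = ∃ λ r → r ≤ L c × x ~ p c r

  AttachedTo? : ∀ c x → Dec (AttachedTo c x)
  AttachedTo? c x = any≤? (λ r → x ~ p c r) (λ r → adjacent? x (p c r)) (L c)

  record Attachments (x : Vertex) (c : Fin 3) : Set where
    field
      lo hi : ℕ
      lo≤L : lo ≤ L c
      hi≤L : hi ≤ L c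
      lo≤hi : lo ≤ hi
      x~lo : x ~ p c lo
      x~hi : x ~ p c hi
      none-below : ∀ r → r < lo → ¬ x ~ p c r
      none-above : ∀ r → hi < r → r ≤ L c → ¬ x ~ p c r

  attachments : ∀ x c → AttachedTo c x → Attachments x c
  attachments x c (r₀ , r₀≤L , x~r₀) with least-witness (λ r → x ~ p c r) (λ r → adjacent? x (p c r)) r₀ x~r₀
  ... | lo , x~lo , lo≤r₀ , none-below with greatest-witness (λ r → x ~ p c r) (λ r → adjacent? x (p c r)) (L c) r₀ x~r₀ r₀≤L
  ... | hi , x~hi , r₀≤hi , hi≤L , none-above = record
    { lo = lo ; hi = hi ; lo≤L = ≤-trans lo≤r₀ r₀≤L ; hi≤L = hi≤L ; lo≤hi = ≤-trans lo≤r₀ r₀≤hi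
    ; x~lo = x~lo ; x~hi = x~hi ; none-below = none-below ; none-above = none-above }

  record Connector (i j : Fin 3) : Set where
    field
      q0 : Vertex
      qs : List Vertex
      qz : Vertex
      qz-last : LastOf (q0 ∷ qs) qz
      Q-induced : Induced (q0 ∷ qs)
      Q-outside : ∀ {y} → y ∈ (q0 ∷ qs) → Outside y
      Q-attachments : ∀ {y c r} → y ∈ (q0 ∷ qs) → r ≤ L c → y ~ p c r → (y ≡ q0 × c ≡ i) ⊎ (y ≡ qz × c ≡ j)
      q0-attached : AttachedTo i q0
      qz-attached : AttachedTo j qz

  reverse-connector : ∀ {i j} → Connector i j → Connector j i
  reverse-connector C = record
    { q0 = qz
    ; qs = qs′
    ; qz = q0
    ; qz-last = subst-LastOf reversed (HeadOf⇒LastOf-reverse {q0 ∷ qs} first)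
    ; Q-induced = subst Induced reversed (Induced-reverse (q0 ∷ qs) Q-induced)
    ; Q-outside = Q-outside ∘ ∈-reversed
    ; Q-attachments = λ y∈ r≤L y~p → Data.Sum.swap (Q-attachments (∈-reversed y∈) r≤L y~p)
    ; q0-attached = qz-attached
    ; qz-attached = q0-attached }
    where
    open Connector C
    reversed-shape : ∃ λ qs′ → reverse (q0 ∷ qs) ≡ qz ∷ qs′
    reversed-shape = HeadOf⇒≡∷ (LastOf⇒HeadOf-reverse qz-last)
    qs′ : List Vertex
    qs′ = proj₁ reversed-shape
    reversed : reverse (q0 ∷ qs) ≡ qz ∷ qs′
    reversed = proj₂ reversed-shape
    ∈-reversed : ∀ {y} → y ∈ (qz ∷ qs′) → y ∈ (q0 ∷ qs)
    ∈-reversed {y} y∈ = AnyP.reverse⁻ (subst (y ∈_) (sym reversed) y∈)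

  InΣ? : ∀ y → Dec (Py.InΣ y)
  InΣ? y = FP.any? (λ c → FP.any? (λ f → Path.vtx (Py.P c) f FP.≟ y))

  Z? : ∀ z → Dec (Py.Z z)
  Z? z = (z FP.≟ apex) ⊎-dec ((InΣ? z ×-dec adjacent? apex z) ⊎-dec FP.any? (λ c → z FP.≟ Py.b c))

  NZ? : ∀ x → Dec (NZ x)
  NZ? x = FP.any? (λ z → Z? z ×-dec ((x FP.≟ z) ⊎-dec adjacent? x z))

module AttachmentConfigurations (G : Graph) (S : Pyramid G) where
  open InducedLists G
  open PyramidGeometry G S

  module ConnectorGeometry {i j k : Fin 3} (ij : i ≢ j) (ik : i ≢ k) (jk : j ≢ k) (C : Connector i j) where
    open Connector C

    Q : List Vertex
    Q = q0 ∷ qs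

    attached-i⇒q0 : ∀ {y r} → y ∈ Q → r ≤ L i → y ~ p i r → y ≡ q0
    attached-i⇒q0 m le e with Q-attachments m le e
    ... | inj₁ (e1 , _) = e1
    ... | inj₂ (_ , e2) = ⊥-elim (ij e2)

    attached-j⇒qz : ∀ {y r} → y ∈ Q → r ≤ L j → y ~ p j r → y ≡ qz
    attached-j⇒qz m le e with Q-attachments m le e
    ... | inj₁ (_ , e2) = ⊥-elim (ij (sym e2))
    ... | inj₂ (e1 , _) = e1

    ¬attached-k : ∀ {y r} → y ∈ Q → r ≤ L k → ¬ y ~ p k r
    ¬attached-k m le e with Q-attachments m le e
    ... | inj₁ (_ , e2) = ik (sym e2)
    ... | inj₂ (_ , e2) = jk (sym e2)

    q0∈Q : q0 ∈ Q
    q0∈Q = here refl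

    qz∈Q : qz ∈ Q
    qz∈Q = LastOf-∈ qz-last

    q0∉qs : q0 ∈ qs → ⊥
    q0∉qs = Induced-head∉tail q0 qs Q-induced

    Q-apart-p : ∀ {y c r} → y ∈ Q → r ≤ L c → ¬ y ~ p c r → p c r ≢ y × ¬ p c r ~ y
    Q-apart-p m le ne = (λ e → Outside⇒∉P (Q-outside m) _ le (sym e)) , (λ e → ne (~-sym e))

    qs-apart-pi : ∀ {y r} → y ∈ qs → r ≤ L i → p i r ≢ y × ¬ p i r ~ y
    qs-apart-pi m le = Q-apart-p (there m) le (λ e → q0∉qs (subst (_∈ qs) (attached-i⇒q0 (there m) le e) m))

    q0∉NZ : ¬ NZ q0
    q0∉NZ = proj₁ (Q-outside q0∈Q)

    qz∉NZ : ¬ NZ qz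
    qz∉NZ = proj₁ (Q-outside qz∈Q)

    -- Theta between q0 and the apex: P_i[s..0], P_i[s'..L_i]·P_k[L_k..0] and Q·P_j[t..0].
    module WideAttachment (s s' t : ℕ) (s≤L : s ≤ L i) (s'≤L : s' ≤ L i) (t≤L : t ≤ L j)
                  (q0~s : q0 ~ p i s) (q0~s' : q0 ~ p i s') (gap : 2 + s ≤ s')
                  (q0-none-below : ∀ r → r < s → ¬ q0 ~ p i r) (q0-none-above : ∀ r → s' < r → r ≤ L i → ¬ q0 ~ p i r)
                  (qz~t : qz ~ p j t) (qz-none-below : ∀ r → r < t → ¬ qz ~ p j r) where

      2≤s : 2 ≤ s
      2≤s = proj₁ (¬NZ-attachment-inner q0∉NZ i s≤L q0~s)
      s<L : suc s ≤ L i
      s<L = proj₂ (¬NZ-attachment-inner q0∉NZ i s≤L q0~s)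
      2≤t : 2 ≤ t
      2≤t = proj₁ (¬NZ-attachment-inner qz∉NZ j t≤L qz~t)
      t<L : suc t ≤ L j
      t<L = proj₂ (¬NZ-attachment-inner qz∉NZ j t≤L qz~t)
      1≤s' : 1 ≤ s'
      1≤s' = ≤-trans (s≤s z≤n) gap

      nᵢ : ℕ
      nᵢ = L i ∸ s'
      reaches-bᵢ : s' + nᵢ ≡ L i
      reaches-bᵢ = m+[n∸m]≡n s'≤L

      via-k : List Vertex
      via-k = segUp i s' nᵢ ++ segDown k 0 (L k)

      legs : Fin 3 → List Vertex
      legs fz = segDown i 0 s
      legs (fs fz) = via-k
      legs (fs (fs fz)) = qs ++ segDown j 0 t

      leg₀-vertex : ∀ {x} → x ∈ segDown i 0 s → x ≢ apex → ∃ λ r → 1 ≤ r × r ≤ s × p i r ≡ x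
      leg₀-vertex m ne with segDown-∈ i 0 s m
      ... | r , _ , a2 , e = r , p≢apex⇒1≤ i e ne , a2 , e

      leg₁-vertex : ∀ {x} → x ∈ via-k → x ≢ apex → (∃ λ r → s' ≤ r × r ≤ L i × p i r ≡ x) ⊎ (∃ λ r → 1 ≤ r × r ≤ L k × p k r ≡ x)
      leg₁-vertex m ne with ∈-++⁻ (segUp i s' nᵢ) m
      ... | inj₁ m' with segUp-∈ i s' nᵢ m'
      ...   | r , a1 , a2 , e = inj₁ (r , a1 , subst (r ≤_) reaches-bᵢ a2 , e)
      leg₁-vertex m ne | inj₂ m' with segDown-∈ k 0 (L k) m'
      ...   | r , _ , a2 , e = inj₂ (r , p≢apex⇒1≤ k e ne , a2 , e)

      leg₂-vertex : ∀ {x} → x ∈ qs ++ segDown j 0 t → x ≢ apex → x ∈ qs ⊎ (∃ λ r → 1 ≤ r × r ≤ t × p j r ≡ x)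
      leg₂-vertex m ne with ∈-++⁻ qs m
      ... | inj₁ m' = inj₁ m'
      ... | inj₂ m' with segDown-∈ j 0 t m'
      ...   | r , _ , a2 , e = inj₂ (r , p≢apex⇒1≤ j e ne , a2 , e)

      apart₀₁ : ApartOutside apex (legs fz) (legs (fs fz))
      apart₀₁ mx nx my ny with leg₀-vertex mx nx | leg₁-vertex my ny
      ... | r , h , rs , refl | inj₁ (r' , a1 , a2 , refl) = p-far⇒apart i a2 (≤-trans (+-monoʳ-≤ 2 rs) (≤-trans gap a1))
      ... | r , h , rs , refl | inj₂ (r' , h' , a2 , refl) = p-apart i k ik h (≤-trans (s≤s rs) s<L) h' a2

      apart₀₂ : ApartOutside apex (legs fz) (legs (fs (fs fz)))
      apart₀₂ mx nx my ny with leg₀-vertex mx nx | leg₂-vertex my ny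
      ... | r , h , rs , refl | inj₁ myq = qs-apart-pi myq (≤-trans rs (<⇒≤ s<L))
      ... | r , h , rs , refl | inj₂ (r' , h' , a2 , refl) = p-apart i j ij h (≤-trans (s≤s rs) s<L) h' (≤-trans a2 (<⇒≤ t<L))

      apart₁₂ : ApartOutside apex (legs (fs fz)) (legs (fs (fs fz)))
      apart₁₂ mx nx my ny with leg₁-vertex mx nx | leg₂-vertex my ny
      ... | inj₁ (r , a1 , a2 , refl) | inj₁ myq = qs-apart-pi myq a2
      ... | inj₁ (r , a1 , a2 , refl) | inj₂ (r' , h' , b2 , refl) = p-apart˘ i j ij (≤-trans 1≤s' a1) a2 h' (≤-trans (s≤s b2) t<L)
      ... | inj₂ (r , h , a2 , refl) | inj₁ myq = Q-apart-p (there myq) a2 (¬attached-k (there myq) a2)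
      ... | inj₂ (r , h , a2 , refl) | inj₂ (r' , h' , b2 , refl) = p-apart˘ k j (λ e → jk (sym e)) h a2 h' (≤-trans (s≤s b2) t<L)

      legs-apart : ∀ c d → c ≢ d → ApartOutside apex (legs c) (legs d)
      legs-apart = Fin3-pairwise (λ c d → ApartOutside apex (legs c) (legs d)) ApartOutside-sym apart₀₁ apart₀₂ apart₁₂

      leg₀-induced : Induced (q0 ∷ segDown i 0 s)
      leg₀-induced = Induced-∷ q0 (segDown i 0 s) (segDown-induced i 0 s s≤L) (λ { first → q0~s }) q0-meets-head
        where
        q0-meets-head : ∀ {y} → y ∈ segDown i 0 s → q0 ≢ y × (q0 ~ y → HeadOf (segDown i 0 s) y)
        q0-meets-head m with segDown-∈ i 0 s m
        ... | r , _ , rs , refl = Outside⇒∉P (Q-outside q0∈Q) i (≤-trans rs s≤L) ,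
              λ e → HeadOf-≡ first (cong (p i) (sym (≤-least⇒≡ q0-none-below rs e)))

      via-k-induced : Induced via-k
      via-k-induced = Induced-++ (segUp i s' nᵢ) (segDown k 0 (L k)) (segUp-induced i s' nᵢ (≤-reflexive reaches-bᵢ)) (segDown-induced k 0 (L k) ≤-refl) seam meet
        where
        seam : SeamAdjacent (segUp i s' nᵢ) (segDown k 0 (L k))
        seam lx first = subst (_~ p k (L k)) (sym (trans (LastOf-unique lx (segUp-last i s' nᵢ)) (cong (p i) reaches-bᵢ))) (base~base i k ik)
        meet-at : ∀ r r' → s' ≤ r → r ≤ L i → r' ≤ L k → p i r ≢ p k r' × (p i r ~ p k r' → LastOf (segUp i s' nᵢ) (p i r) × HeadOf (segDown k 0 (L k)) (p k r'))
        meet-at r zero a1 rL _ = (λ e → p≢apex i (≤-trans 1≤s' a1) rL (trans e (p-apex k))) ,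
          λ e → ⊥-elim (1+n≰n (≤-trans (≤-trans (s≤s (s≤s z≤n)) (≤-trans 2≤s' a1)) (≤-reflexive (apex-adj⇒1 i rL (~-sym (subst (p i r ~_) (p-apex k) e))))))
          where
          2≤s' : 2 ≤ s'
          2≤s' = ≤-trans (s≤s (s≤s z≤n)) gap
        meet-at r (suc r') a1 rL b2 = p-disjoint i k ik (≤-trans 1≤s' a1) rL b2 ,
          λ e → at-bases (p-cross-edge⇒bases i k ik (≤-trans 1≤s' a1) rL (s≤s z≤n) b2 e)
          where
          at-bases : r ≡ L i × suc r' ≡ L k → LastOf (segUp i s' nᵢ) (p i r) × HeadOf (segDown k 0 (L k)) (p k (suc r'))
          at-bases (q1 , q2) = LastOf-≡ (segUp-last i s' nᵢ) (cong (p i) (trans reaches-bᵢ (sym q1))) , HeadOf-≡ first (cong (p k) (sym q2))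
        meet : MeetOnlyAtSeam (segUp i s' nᵢ) (segDown k 0 (L k))
        meet mx my with segUp-∈ i s' nᵢ mx | segDown-∈ k 0 (L k) my
        ... | r , a1 , a2 , refl | r' , _ , b2 , refl = meet-at r r' a1 (subst (r ≤_) reaches-bᵢ a2) b2

      leg₁-induced : Induced (q0 ∷ via-k)
      leg₁-induced = Induced-∷ q0 via-k via-k-induced (λ { first → q0~s' }) q0-meets-via-k-head
        where
        q0-meets-via-k-head : ∀ {y} → y ∈ via-k → q0 ≢ y × (q0 ~ y → HeadOf via-k y)
        q0-meets-via-k-head m with ∈-++⁻ (segUp i s' nᵢ) m
        ... | inj₁ m' with segUp-∈ i s' nᵢ m'
        ...   | r , a1 , a2 , refl = Outside⇒∉P (Q-outside q0∈Q) i (subst (r ≤_) reaches-bᵢ a2) ,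
                λ e → HeadOf-≡ first (cong (p i) (sym (≥-greatest⇒≡ q0-none-above a1 (subst (r ≤_) reaches-bᵢ a2) e)))
        q0-meets-via-k-head m | inj₂ m' with segDown-∈ k 0 (L k) m'
        ...   | r , _ , a2 , refl = Outside⇒∉P (Q-outside q0∈Q) k a2 , λ e → ⊥-elim (¬attached-k q0∈Q a2 e)

      leg₂-induced : Induced (q0 ∷ (qs ++ segDown j 0 t))
      leg₂-induced = Induced-++ Q (segDown j 0 t) Q-induced (segDown-induced j 0 t t≤L) seam meet
        where
        seam : SeamAdjacent Q (segDown j 0 t)
        seam lx first = subst (_~ p j t) (sym (LastOf-unique lx qz-last)) qz~t
        meet : MeetOnlyAtSeam Q (segDown j 0 t)
        meet {x} mx my with segDown-∈ j 0 t my
        ... | r , _ , rt , refl = Outside⇒∉P (Q-outside mx) j (≤-trans rt t≤L) ,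
              λ e → LastOf-≡ qz-last (sym (attached-j⇒qz mx (≤-trans rt t≤L) e)) ,
                    HeadOf-≡ first (cong (p j) (sym (≤-least⇒≡ qz-none-below rt (subst (_~ p j r) (attached-j⇒qz mx (≤-trans rt t≤L) e) e))))

      legs-induced : ∀ c → Induced (q0 ∷ legs c)
      legs-induced fz = leg₀-induced
      legs-induced (fs fz) = leg₁-induced
      legs-induced (fs (fs fz)) = leg₂-induced

      legs-end : ∀ c → LastOf (q0 ∷ legs c) apex
      legs-end fz = LastOf-≡ (LastOf-∷ (segDown-last i 0 s)) (p-apex i)
      legs-end (fs fz) = LastOf-≡ (LastOf-∷ (LastOf-++ (segUp i s' nᵢ) (segDown-last k 0 (L k)))) (p-apex k)
      legs-end (fs (fs fz)) = LastOf-≡ (LastOf-++ Q (segDown-last j 0 t)) (p-apex j)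

      legs-long : ∀ c → 2 ≤ length (legs c)
      legs-long fz = subst (2 ≤_) (sym (segDown-length i 0 s)) (s≤s (≤-trans (s≤s z≤n) 2≤s))
      legs-long (fs fz) = ≤-trans (subst (2 ≤_) (sym (segDown-length k 0 (L k))) (s≤s (L≥1 k))) (LP.length-++-≤ʳ (segDown k 0 (L k)) {segUp i s' nᵢ})
      legs-long (fs (fs fz)) = ≤-trans (subst (2 ≤_) (sym (segDown-length j 0 t)) (s≤s (≤-trans (s≤s z≤n) 2≤t))) (LP.length-++-≤ʳ (segDown j 0 t) {qs})

      result : Theta G
      result = theta q0 apex (¬NZ⇒≁apex q0∉NZ) legs legs-induced legs-end legs-long legs-apart

    -- Prism on {p i (s+1), q0, p i s} and the base, with rungs P_i[s+1..L_i], Q·P_j[t'..L_j]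
    -- and P_i[s..1]·P_k[0..L_k].
    module TriangleAttachment (s1 t' : ℕ) (s+1≤L : suc (suc s1) ≤ L i) (t'≤L : t' ≤ L j)
               (q0~s : q0 ~ p i (suc s1)) (q0~s+1 : q0 ~ p i (suc (suc s1)))
               (q0-none-below : ∀ r → r < suc s1 → ¬ q0 ~ p i r) (q0-none-above : ∀ r → suc (suc s1) < r → r ≤ L i → ¬ q0 ~ p i r)
               (qz~t' : qz ~ p j t') (qz-none-above : ∀ r → t' < r → r ≤ L j → ¬ qz ~ p j r) where
      s : ℕ
      s = suc s1
      s+1<L : suc (suc s) ≤ L i
      s+1<L = proj₂ (¬NZ-attachment-inner q0∉NZ i s+1≤L q0~s+1)
      2≤t' : 2 ≤ t'
      2≤t' = proj₁ (¬NZ-attachment-inner qz∉NZ j t'≤L qz~t')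
      2≤s : 2 ≤ s
      2≤s = proj₁ (¬NZ-attachment-inner q0∉NZ i (≤-trans (n≤1+n s) s+1≤L) q0~s)

      nᵢ : ℕ
      nᵢ = L i ∸ suc s
      reaches-bᵢ : suc s + nᵢ ≡ L i
      reaches-bᵢ = m+[n∸m]≡n s+1≤L
      nⱼ : ℕ
      nⱼ = L j ∸ t'
      reaches-bⱼ : t' + nⱼ ≡ L j
      reaches-bⱼ = m+[n∸m]≡n t'≤L

      rung₀ rung₁ rung₂ : List Vertex
      rung₀ = segUp i (suc s) nᵢ
      rung₁ = Q ++ segUp j t' nⱼ
      rung₂ = segDown i 1 s1 ++ segUp k 0 (L k)

      top : Fin 3 → Vertex
      top fz = p i (suc s)
      top (fs fz) = q0
      top (fs (fs fz)) = p i s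

      rungs : Fin 3 → List Vertex
      rungs fz = segUp-tail i (suc s) nᵢ
      rungs (fs fz) = qs ++ segUp j t' nⱼ
      rungs (fs (fs fz)) = segDown-tail i 1 s1 ++ segUp k 0 (L k)

      rung₀-vertex : ∀ {x} → x ∈ rung₀ → ∃ λ r → suc s ≤ r × r ≤ L i × p i r ≡ x
      rung₀-vertex m with segUp-∈ i (suc s) nᵢ m
      ... | r , a1 , a2 , e = r , a1 , subst (r ≤_) reaches-bᵢ a2 , e

      rung₁-vertex : ∀ {x} → x ∈ rung₁ → x ∈ Q ⊎ (∃ λ r → t' ≤ r × r ≤ L j × p j r ≡ x)
      rung₁-vertex m with ∈-++⁻ Q m
      ... | inj₁ m' = inj₁ m'
      ... | inj₂ m' with segUp-∈ j t' nⱼ m'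
      ...   | r , a1 , a2 , e = inj₂ (r , a1 , subst (r ≤_) reaches-bⱼ a2 , e)

      rung₂-vertex : ∀ {x} → x ∈ rung₂ → (∃ λ r → 1 ≤ r × r ≤ s × p i r ≡ x) ⊎ (∃ λ r → r ≤ L k × p k r ≡ x)
      rung₂-vertex m with ∈-++⁻ (segDown i 1 s1) m
      ... | inj₁ m' = inj₁ (segDown-∈ i 1 s1 m')
      ... | inj₂ m' with segUp-∈ k 0 (L k) m'
      ...   | r , _ , a2 , e = inj₂ (r , a2 , e)

      rung₀-last : LastOf rung₀ (p i (L i))
      rung₀-last = LastOf-≡ (segUp-last i (suc s) nᵢ) (cong (p i) reaches-bᵢ)
      rung₁-last : LastOf rung₁ (p j (L j))
      rung₁-last = LastOf-++ Q (LastOf-≡ (segUp-last j t' nⱼ) (cong (p j) reaches-bⱼ))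
      rung₂-last : LastOf rung₂ (p k (L k))
      rung₂-last = LastOf-++ (segDown i 1 s1) (segUp-last k 0 (L k))

      legs-induced : ∀ c → Induced (top c ∷ rungs c)
      legs-induced fz = segUp-induced i (suc s) nᵢ (≤-reflexive reaches-bᵢ)
      legs-induced (fs fz) = Induced-++ Q (segUp j t' nⱼ) Q-induced (segUp-induced j t' nⱼ (≤-reflexive reaches-bⱼ)) seam meet
        where
        seam : SeamAdjacent Q (segUp j t' nⱼ)
        seam lx first = subst (_~ p j t') (sym (LastOf-unique lx qz-last)) qz~t'
        meet : MeetOnlyAtSeam Q (segUp j t' nⱼ)
        meet {x} mx my with segUp-∈ j t' nⱼ my
        ... | r , a1 , a2 , refl = Outside⇒∉P (Q-outside mx) j (subst (r ≤_) reaches-bⱼ a2) ,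
              λ e → LastOf-≡ qz-last (sym (attached-j⇒qz mx (subst (r ≤_) reaches-bⱼ a2) e)) ,
                    HeadOf-≡ first (cong (p j) (sym (≥-greatest⇒≡ qz-none-above a1 (subst (r ≤_) reaches-bⱼ a2) (subst (_~ p j r) (attached-j⇒qz mx (subst (r ≤_) reaches-bⱼ a2) e) e))))
      legs-induced (fs (fs fz)) = Induced-++ (segDown i 1 s1) (segUp k 0 (L k)) (segDown-induced i 1 s1 (≤-trans (n≤1+n s) s+1≤L)) (segUp-induced k 0 (L k) ≤-refl) seam meet
        where
        seam : SeamAdjacent (segDown i 1 s1) (segUp k 0 (L k))
        seam lx first = subst₂ _~_ (sym (LastOf-unique lx (segDown-last i 1 s1))) refl (~-sym (subst (_~ p i 1) (sym (p-apex k)) (apex~p1 i)))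
        meet-at : ∀ r r' → 1 ≤ r → r ≤ s → r' ≤ L k → p i r ≢ p k r' × (p i r ~ p k r' → LastOf (segDown i 1 s1) (p i r) × HeadOf (segUp k 0 (L k)) (p k r'))
        meet-at r zero h1 rs _ = (λ e → p≢apex i h1 (≤-trans rs (≤-trans (n≤1+n s) s+1≤L)) (trans e (p-apex k))) ,
          λ e → LastOf-≡ (segDown-last i 1 s1) (cong (p i) (sym (apex-adj⇒1 i (≤-trans rs (≤-trans (n≤1+n s) s+1≤L)) (~-sym (subst (p i r ~_) (p-apex k) e))))) , first
        meet-at r (suc r') h1 rs b2 = weaken-apart (p-apart i k ik h1 (≤-trans (s≤s rs) s+1≤L) (s≤s z≤n) b2)
        meet : MeetOnlyAtSeam (segDown i 1 s1) (segUp k 0 (L k))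
        meet mx my with segDown-∈ i 1 s1 mx | segUp-∈ k 0 (L k) my
        ... | r , a1 , a2 , refl | r' , _ , b2 , refl = meet-at r r' a1 a2 b2

      joined₀₁ : JoinedAtEnds rung₀ rung₁
      joined₀₁ mx my with rung₀-vertex mx | rung₁-vertex my
      ... | r , a1 , a2 , refl | inj₁ myq = (λ e → Outside⇒∉P (Q-outside myq) i a2 (sym e)) ,
            λ e → inj₁ (HeadOf-≡ first (cong (p i) (sym (≥-greatest⇒≡ q0-none-above a1 a2 (subst (_~ p i r) (attached-i⇒q0 myq a2 (~-sym e)) (~-sym e))))) ,
                        HeadOf-≡ first (sym (attached-i⇒q0 myq a2 (~-sym e))))
      ... | r , a1 , a2 , refl | inj₂ (r' , b1 , b2 , refl) =
            p-disjoint i j ij (≤-trans (s≤s z≤n) a1) a2 b2 ,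
            λ e → at-bases (p-cross-edge⇒bases i j ij (≤-trans (s≤s z≤n) a1) a2 (≤-trans (s≤s z≤n) (≤-trans 2≤t' b1)) b2 e)
        where
        at-bases : r ≡ L i × r' ≡ L j → AtSameEnds rung₀ rung₁ (p i r) (p j r')
        at-bases (q1 , q2) = inj₂ (LastOf-≡ rung₀-last (cong (p i) (sym q1)) , LastOf-≡ rung₁-last (cong (p j) (sym q2)))

      joined₀₂ : JoinedAtEnds rung₀ rung₂
      joined₀₂ mx my with rung₀-vertex mx | rung₂-vertex my
      ... | r , a1 , a2 , refl | inj₁ (r' , b1 , b2 , refl) =
            (λ e → 1+n≰n (≤-trans (s≤s b2) (≤-trans a1 (≤-reflexive (p-injective i a2 (≤-trans b2 (≤-trans (n≤1+n s) s+1≤L)) e))))) ,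
            λ e → consecutive (p-adj⇒consec i a2 (≤-trans b2 (≤-trans (n≤1+n s) s+1≤L)) e)
        where
        consecutive : Consec G r r' → AtSameEnds rung₀ rung₂ (p i r) (p i r')
        consecutive (inj₁ refl) = ⊥-elim (1+n≰n (≤-trans (s≤s (≤-trans (n≤1+n _) a1)) b2))
        consecutive (inj₂ refl) = inj₁ (HeadOf-≡ first (cong (p i) (cong suc (sym q))) , HeadOf-≡ first (cong (p i) (sym q)))
          where
          q : r' ≡ s
          q = ≤-antisym b2 (≤-pred a1)
      ... | r , a1 , a2 , refl | inj₂ (zero , b2 , refl) =
            (λ e → p≢apex i (≤-trans (s≤s z≤n) a1) a2 (trans e (p-apex k))) ,
            λ e → ⊥-elim (1+n≰n (≤-trans (≤-trans 2≤s (≤-trans (n≤1+n s) a1)) (≤-reflexive (apex-adj⇒1 i a2 (~-sym (subst (p i r ~_) (p-apex k) e))))))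
      ... | r , a1 , a2 , refl | inj₂ (suc r' , b2 , refl) =
            p-disjoint i k ik (≤-trans (s≤s z≤n) a1) a2 b2 ,
            λ e → at-bases (p-cross-edge⇒bases i k ik (≤-trans (s≤s z≤n) a1) a2 (s≤s z≤n) b2 e)
        where
        at-bases : r ≡ L i × suc r' ≡ L k → AtSameEnds rung₀ rung₂ (p i r) (p k (suc r'))
        at-bases (q1 , q2) = inj₂ (LastOf-≡ rung₀-last (cong (p i) (sym q1)) , LastOf-≡ rung₂-last (cong (p k) (sym q2)))

      joined₁₂ : JoinedAtEnds rung₁ rung₂
      joined₁₂ mx my with rung₁-vertex mx | rung₂-vertex my
      ... | inj₁ mxq | inj₁ (r , b1 , b2 , refl) =
            Outside⇒∉P (Q-outside mxq) i (≤-trans b2 (≤-trans (n≤1+n s) s+1≤L)) ,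
            λ e → inj₁ (HeadOf-≡ first (sym (attached-i⇒q0 mxq rl e)) , HeadOf-≡ first (cong (p i) (sym (≤-least⇒≡ q0-none-below b2 (subst (_~ p i r) (attached-i⇒q0 mxq rl e) e)))))
        where
        rl : r ≤ L i
        rl = ≤-trans b2 (≤-trans (n≤1+n s) s+1≤L)
      ... | inj₁ mxq | inj₂ (r , b2 , refl) = Outside⇒∉P (Q-outside mxq) k b2 , λ e → ⊥-elim (¬attached-k mxq b2 e)
      ... | inj₂ (r' , a1 , a2 , refl) | inj₁ (r , b1 , b2 , refl) =
            weaken-apart (p-apart˘ j i (ij ∘ sym) (≤-trans (s≤s z≤n) (≤-trans 2≤t' a1)) a2 b1 (≤-trans (s≤s b2) s+1≤L))
      ... | inj₂ (r' , a1 , a2 , refl) | inj₂ (zero , b2 , refl) =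
            (λ e → p≢apex j (≤-trans (s≤s z≤n) (≤-trans 2≤t' a1)) a2 (trans e (p-apex k))) ,
            λ e → ⊥-elim (1+n≰n (≤-trans (≤-trans 2≤t' a1) (≤-reflexive (apex-adj⇒1 j a2 (~-sym (subst (p j r' ~_) (p-apex k) e))))))
      ... | inj₂ (r' , a1 , a2 , refl) | inj₂ (suc r , b2 , refl) =
            p-disjoint j k jk (≤-trans (s≤s z≤n) (≤-trans 2≤t' a1)) a2 b2 ,
            λ e → at-bases (p-cross-edge⇒bases j k jk (≤-trans (s≤s z≤n) (≤-trans 2≤t' a1)) a2 (s≤s z≤n) b2 e)
        where
        at-bases : r' ≡ L j × suc r ≡ L k → AtSameEnds rung₁ rung₂ (p j r') (p k (suc r))
        at-bases (q1 , q2) = inj₂ (LastOf-≡ rung₁-last (cong (p j) (sym q1)) , LastOf-≡ rung₂-last (cong (p k) (sym q2)))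

      rungs-joined : ∀ c d → c ≢ d → JoinedAtEnds (top c ∷ rungs c) (top d ∷ rungs d)
      rungs-joined = Fin3-pairwise (λ c d → JoinedAtEnds (top c ∷ rungs c) (top d ∷ rungs d)) JoinedAtEnds-sym joined₀₁ joined₀₂ joined₁₂

      rungs-nonempty : ∀ c → 1 ≤ length (rungs c)
      rungs-nonempty fz = subst (1 ≤_) (sym (segUp-tail-length i (suc s) nᵢ)) (m<n⇒0<n∸m s+1<L)
      rungs-nonempty (fs fz) = ≤-trans (subst (1 ≤_) (sym (segUp-length j t' nⱼ)) (s≤s z≤n)) (LP.length-++-≤ʳ (segUp j t' nⱼ) {qs})
      rungs-nonempty (fs (fs fz)) = ≤-trans (subst (1 ≤_) (sym (segUp-length k 0 (L k))) (s≤s z≤n)) (LP.length-++-≤ʳ (segUp k 0 (L k)) {segDown-tail i 1 s1})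

      top₀₁ : top fz ~ top (fs fz)
      top₀₁ = ~-sym q0~s+1
      top₀₂ : top fz ~ top (fs (fs fz))
      top₀₂ = ~-sym (p-adj-suc i s+1≤L)
      top₁₂ : top (fs fz) ~ top (fs (fs fz))
      top₁₂ = q0~s

      top-triangle : ∀ c d → c ≢ d → top c ~ top d
      top-triangle = Fin3-pairwise (λ c d → top c ~ top d) ~-sym top₀₁ top₀₂ top₁₂

      bottom-path : Fin 3 → Fin 3
      bottom-path fz = i
      bottom-path (fs fz) = j
      bottom-path (fs (fs fz)) = k

      rungs-last : ∀ c → LastOf (top c ∷ rungs c) (p (bottom-path c) (L (bottom-path c)))
      rungs-last fz = rung₀-last
      rungs-last (fs fz) = rung₁-last
      rungs-last (fs (fs fz)) = rung₂-last

      bottom-path-injective : ∀ c d → c ≢ d → bottom-path c ≢ bottom-path d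
      bottom-path-injective = Fin3-pairwise (λ c d → bottom-path c ≢ bottom-path d) (_∘ sym) ij ik jk

      bottom-triangle : ∀ c d → c ≢ d → lastVertex (top c) (rungs c) ~ lastVertex (top d) (rungs d)
      bottom-triangle c d cd = subst₂ _~_ (LastOf-unique (rungs-last c) (lastVertex-LastOf (top c) (rungs c))) (LastOf-unique (rungs-last d) (lastVertex-LastOf (top d) (rungs d)))
                    (base~base (bottom-path c) (bottom-path d) (bottom-path-injective c d cd))

      result : Prism G
      result = prism top rungs legs-induced rungs-nonempty rungs-joined top-triangle bottom-triangle

    -- Theta between p i s and p j t: Q, P_i[s..0]·P_j[1..t] and P_i[s..L_i]·P_j[L_j..t].
    module SingleAttachments (s1 t1 : ℕ) (s≤L : suc s1 ≤ L i) (t≤L : suc t1 ≤ L j)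
                  (q0~s : q0 ~ p i (suc s1)) (only-s : ∀ r → r ≤ L i → q0 ~ p i r → r ≡ suc s1)
                  (qz~t : qz ~ p j (suc t1)) (only-t : ∀ r → r ≤ L j → qz ~ p j r → r ≡ suc t1) where
      s t : ℕ
      s = suc s1
      t = suc t1
      sv tv : Vertex
      sv = p i s
      tv = p j t
      s<L : suc s ≤ L i
      s<L = proj₂ (¬NZ-attachment-inner q0∉NZ i s≤L q0~s)
      t<L : suc t ≤ L j
      t<L = proj₂ (¬NZ-attachment-inner qz∉NZ j t≤L qz~t)
      2≤s : 2 ≤ s
      2≤s = proj₁ (¬NZ-attachment-inner q0∉NZ i s≤L q0~s)
      2≤t : 2 ≤ t
      2≤t = proj₁ (¬NZ-attachment-inner qz∉NZ j t≤L qz~t)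
      nᵢ nⱼ : ℕ
      nᵢ = L i ∸ s
      nⱼ = L j ∸ t
      reaches-bᵢ : s + nᵢ ≡ L i
      reaches-bᵢ = m+[n∸m]≡n s≤L
      reaches-bⱼ : t + nⱼ ≡ L j
      reaches-bⱼ = m+[n∸m]≡n t≤L

      legs : Fin 3 → List Vertex
      legs fz = Q ++ [ tv ]
      legs (fs fz) = segDown i 0 s1 ++ segUp j 1 t1
      legs (fs (fs fz)) = segUp-tail i s nᵢ ++ segDown j t nⱼ

      sv-apart-tv : sv ≢ tv × ¬ sv ~ tv
      sv-apart-tv = p-apart i j ij (s≤s z≤n) s<L (s≤s z≤n) t≤L

      leg₀-induced : Induced (sv ∷ (Q ++ [ tv ]))
      leg₀-induced = Induced-++ (sv ∷ Q) [ tv ] sv-Q-induced tt seam meet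
        where
        sv-Q-induced : Induced (sv ∷ Q)
        sv-Q-induced = Induced-∷ sv Q Q-induced (λ { first → ~-sym q0~s })
          (λ m → (λ e → Outside⇒∉P (Q-outside m) i s≤L (sym e)) , λ e → HeadOf-≡ first (sym (attached-i⇒q0 m s≤L (~-sym e))))
        seam : SeamAdjacent (sv ∷ Q) [ tv ]
        seam (last-∷ lx) first = subst (_~ tv) (sym (LastOf-unique lx qz-last)) qz~t
        meet : MeetOnlyAtSeam (sv ∷ Q) [ tv ]
        meet (here refl) (here refl) = weaken-apart sv-apart-tv
        meet (there mx) (here refl) = Outside⇒∉P (Q-outside mx) j t≤L , λ e → LastOf-∷ (LastOf-≡ qz-last (sym (attached-j⇒qz mx t≤L e))) , first

      leg₁-induced : Induced (segDown i 0 s ++ segUp j 1 t1)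
      leg₁-induced = Induced-++ (segDown i 0 s) (segUp j 1 t1) (segDown-induced i 0 s s≤L) (segUp-induced j 1 t1 t≤L) seam meet
        where
        seam : SeamAdjacent (segDown i 0 s) (segUp j 1 t1)
        seam lx first = subst (_~ p j 1) (sym (trans (LastOf-unique lx (segDown-last i 0 s)) (p-apex i))) (apex~p1 j)
        meet-at : ∀ r r' → r ≤ s → 1 ≤ r' → r' ≤ t → p i r ≢ p j r' × (p i r ~ p j r' → LastOf (segDown i 0 s) (p i r) × HeadOf (segUp j 1 t1) (p j r'))
        meet-at zero r' _ h' b2 = (λ e → p≢apex j h' (≤-trans b2 t≤L) (trans (sym e) (p-apex i))) ,
          λ e → LastOf-≡ (segDown-last i 0 s) refl , HeadOf-≡ first (cong (p j) (sym (apex-adj⇒1 j (≤-trans b2 t≤L) (subst (_~ p j r') (p-apex i) e))))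
        meet-at (suc r) r' rs h' b2 = weaken-apart (p-apart i j ij (s≤s z≤n) (≤-trans (s≤s rs) s<L) h' (≤-trans b2 t≤L))
        meet : MeetOnlyAtSeam (segDown i 0 s) (segUp j 1 t1)
        meet mx my with segDown-∈ i 0 s mx | segUp-∈ j 1 t1 my
        ... | r , _ , a2 , refl | r' , b1 , b2 , refl = meet-at r r' a2 b1 b2

      leg₂-induced : Induced (segUp i s nᵢ ++ segDown j t nⱼ)
      leg₂-induced = Induced-++ (segUp i s nᵢ) (segDown j t nⱼ) (segUp-induced i s nᵢ (≤-reflexive reaches-bᵢ)) (segDown-induced j t nⱼ (≤-reflexive reaches-bⱼ)) seam meet
        where
        seam : SeamAdjacent (segUp i s nᵢ) (segDown j t nⱼ)
        seam lx first = subst₂ _~_ (sym (trans (LastOf-unique lx (segUp-last i s nᵢ)) (cong (p i) reaches-bᵢ))) (cong (p j) (sym reaches-bⱼ)) (base~base i j ij)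
        meet : MeetOnlyAtSeam (segUp i s nᵢ) (segDown j t nⱼ)
        meet mx my with segUp-∈ i s nᵢ mx | segDown-∈ j t nⱼ my
        ... | r , a1 , a2 , refl | r' , b1 , b2 , refl =
              p-disjoint i j ij (≤-trans (s≤s z≤n) (≤-trans 2≤s a1)) (subst (r ≤_) reaches-bᵢ a2) (subst (r' ≤_) reaches-bⱼ b2) ,
              λ e → at-bases (p-cross-edge⇒bases i j ij (≤-trans (s≤s z≤n) (≤-trans 2≤s a1)) (subst (r ≤_) reaches-bᵢ a2) (≤-trans (s≤s z≤n) (≤-trans 2≤t b1)) (subst (r' ≤_) reaches-bⱼ b2) e)
          where
          at-bases : r ≡ L i × r' ≡ L j → LastOf (segUp i s nᵢ) (p i r) × HeadOf (segDown j t nⱼ) (p j r')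
          at-bases (q1 , q2) = LastOf-≡ (segUp-last i s nᵢ) (cong (p i) (trans reaches-bᵢ (sym q1))) , HeadOf-≡ first (cong (p j) (trans reaches-bⱼ (sym q2)))

      legs-induced : ∀ c → Induced (sv ∷ legs c)
      legs-induced fz = leg₀-induced
      legs-induced (fs fz) = leg₁-induced
      legs-induced (fs (fs fz)) = leg₂-induced

      legs-end : ∀ c → LastOf (sv ∷ legs c) tv
      legs-end fz = LastOf-++ (sv ∷ Q) last-[]
      legs-end (fs fz) = LastOf-++ (segDown i 0 s) (segUp-last j 1 t1)
      legs-end (fs (fs fz)) = LastOf-++ (segUp i s nᵢ) (segDown-last j t nⱼ)

      legs-long : ∀ c → 2 ≤ length (legs c)
      legs-long fz = s≤s (LP.length-++-≤ʳ [ tv ] {qs})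
      legs-long (fs fz) = ≤-trans (subst (2 ≤_) (sym (segDown-length i 0 s1)) (s≤s (≤-pred 2≤s))) (LP.length-++-≤ˡ (segDown i 0 s1))
      legs-long (fs (fs fz)) = subst (2 ≤_) (sym (trans (LP.length-++ (segUp-tail i s nᵢ)) (cong₂ _+_ (segUp-tail-length i s nᵢ) (segDown-length j t nⱼ))))
                           (≤-trans (s≤s (s≤s z≤n)) (≤-trans (+-monoˡ-≤ (suc nⱼ) (m<n⇒0<n∸m s<L)) ≤-refl))

      leg₀-vertex : ∀ {x} → x ∈ legs fz → x ≢ tv → x ∈ Q
      leg₀-vertex m ne with ∈-++⁻ Q m
      ... | inj₁ m' = m'
      ... | inj₂ (here e) = ⊥-elim (ne e)

      leg₁-vertex : ∀ {x} → x ∈ legs (fs fz) → x ≢ tv → (∃ λ r → r ≤ s1 × p i r ≡ x) ⊎ (∃ λ r → 1 ≤ r × suc r ≤ t × p j r ≡ x)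
      leg₁-vertex m ne with ∈-++⁻ (segDown i 0 s1) m
      ... | inj₁ m' with segDown-∈ i 0 s1 m'
      ...   | r , _ , a2 , e = inj₁ (r , a2 , e)
      leg₁-vertex m ne | inj₂ m' with segUp-∈ j 1 t1 m'
      ...   | r , a1 , a2 , e with m≤n⇒m<n∨m≡n a2
      ...     | inj₁ lt = inj₂ (r , a1 , lt , e)
      ...     | inj₂ refl = ⊥-elim (ne (sym e))

      leg₂-vertex : ∀ {x} → x ∈ legs (fs (fs fz)) → x ≢ tv → (∃ λ r → suc s ≤ r × r ≤ L i × p i r ≡ x) ⊎ (∃ λ r → suc t ≤ r × r ≤ L j × p j r ≡ x)
      leg₂-vertex m ne with ∈-++⁻ (segUp-tail i s nᵢ) m
      ... | inj₁ m' with segUp-tail-∈ i s nᵢ m'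
      ...   | r , a1 , a2 , e = inj₁ (r , a1 , subst (r ≤_) reaches-bᵢ a2 , e)
      leg₂-vertex m ne | inj₂ m' with segDown-∈ j t nⱼ m'
      ...   | r , a1 , a2 , e with m≤n⇒m<n∨m≡n a1
      ...     | inj₁ lt = inj₂ (r , lt , subst (r ≤_) reaches-bⱼ a2 , e)
      ...     | inj₂ refl = ⊥-elim (ne (sym e))

      Q-apart-pi : ∀ {y r} → y ∈ Q → r ≤ L i → r ≢ s → y ≢ p i r × ¬ y ~ p i r
      Q-apart-pi m le ne = Outside⇒∉P (Q-outside m) i le , λ e → ne (only-s _ le (subst (_~ _) (attached-i⇒q0 m le e) e))
      Q-apart-pj : ∀ {y r} → y ∈ Q → r ≤ L j → r ≢ t → y ≢ p j r × ¬ y ~ p j r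
      Q-apart-pj m le ne = Outside⇒∉P (Q-outside m) j le , λ e → ne (only-t _ le (subst (_~ _) (attached-j⇒qz m le e) e))

      apart₀₁ : ApartOutside tv (legs fz) (legs (fs fz))
      apart₀₁ mx nx my ny with leg₀-vertex mx nx | leg₁-vertex my ny
      ... | mq | inj₁ (r , a2 , refl) = Q-apart-pi mq (≤-trans (≤-trans a2 (n≤1+n s1)) (<⇒≤ s<L)) (<⇒≢ (s≤s a2))
      ... | mq | inj₂ (r , a1 , lt , refl) = Q-apart-pj mq (≤-trans (≤-trans (n≤1+n r) lt) t≤L) (<⇒≢ lt)

      apart₀₂ : ApartOutside tv (legs fz) (legs (fs (fs fz)))
      apart₀₂ mx nx my ny with leg₀-vertex mx nx | leg₂-vertex my ny
      ... | mq | inj₁ (r , a1 , a2 , refl) = Q-apart-pi mq a2 (>⇒≢ a1)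
      ... | mq | inj₂ (r , a1 , a2 , refl) = Q-apart-pj mq a2 (>⇒≢ a1)

      apart₁₂ : ApartOutside tv (legs (fs fz)) (legs (fs (fs fz)))
      apart₁₂ mx nx my ny with leg₁-vertex mx nx | leg₂-vertex my ny
      ... | inj₁ (r , a2 , refl) | inj₁ (r' , b1 , b2 , refl) = p-far⇒apart i b2 (≤-trans (s≤s (s≤s a2)) b1)
      ... | inj₁ (zero , a2 , refl) | inj₂ (r' , b1 , b2 , refl) =
            subst (λ z → z ≢ p j r' × ¬ z ~ p j r') (sym (p-apex i)) (apex-apart j (≤-trans 2≤t (≤-trans (n≤1+n t) b1)) b2)
      ... | inj₁ (suc r , a2 , refl) | inj₂ (r' , b1 , b2 , refl) =
            p-apart i j ij (s≤s z≤n) (≤-trans (s≤s (≤-trans a2 (n≤1+n s1))) s<L) (≤-trans (s≤s z≤n) (≤-trans 2≤t (≤-trans (n≤1+n t) b1))) b2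
      ... | inj₂ (r , a1 , lt , refl) | inj₁ (r' , b1 , b2 , refl) =
            p-apart j i (λ e → ij (sym e)) a1 (≤-trans (≤-trans lt (n≤1+n t)) t<L) (≤-trans (s≤s z≤n) (≤-trans 2≤s (≤-trans (n≤1+n s) b1))) b2
      ... | inj₂ (r , a1 , lt , refl) | inj₂ (r' , b1 , b2 , refl) = p-far⇒apart j b2 (≤-trans (s≤s lt) b1)

      legs-apart : ∀ c d → c ≢ d → ApartOutside tv (legs c) (legs d)
      legs-apart = Fin3-pairwise (λ c d → ApartOutside tv (legs c) (legs d)) ApartOutside-sym apart₀₁ apart₀₂ apart₁₂

      result : Theta G
      result = theta sv tv (proj₂ sv-apart-tv) legs legs-induced legs-end legs-long legs-apart

    consecutive-neighbours-prism : ∀ s s' t' → s' ≡ suc s → 2 ≤ s → s' ≤ L i → t' ≤ L j → q0 ~ p i s → q0 ~ p i s' →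
              (∀ r → r < s → ¬ q0 ~ p i r) → (∀ r → s' < r → r ≤ L i → ¬ q0 ~ p i r) →
              qz ~ p j t' → (∀ r → t' < r → r ≤ L j → ¬ qz ~ p j r) → Prism G
    consecutive-neighbours-prism (suc s1) .(suc (suc s1)) t' refl _ s'≤L t'≤L q0~s q0~s+1 q0-none-below q0-none-above qz~t qz-none-above = TriangleAttachment.result s1 t' s'≤L t'≤L q0~s q0~s+1 q0-none-below q0-none-above qz~t qz-none-above

    unique-neighbours-theta : ∀ s s' t t' → s ≡ s' → t ≡ t' → 2 ≤ s → 2 ≤ t → s ≤ L i → t ≤ L j → q0 ~ p i s → qz ~ p j t →
              (∀ r → r < s → ¬ q0 ~ p i r) → (∀ r → s' < r → r ≤ L i → ¬ q0 ~ p i r) →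
              (∀ r → r < t → ¬ qz ~ p j r) → (∀ r → t' < r → r ≤ L j → ¬ qz ~ p j r) → Theta G
    unique-neighbours-theta (suc s1) .(suc s1) (suc t1) .(suc t1) refl refl _ _ s≤L t≤L q0~s qz~t q0-none-below q0-none-above qz-none-below qz-none-above =
      SingleAttachments.result s1 t1 s≤L t≤L q0~s (unique-witness q0-none-below q0-none-above) qz~t (unique-witness qz-none-below qz-none-above)

    wide : (A : Attachments q0 i) (B : Attachments qz j) → 2 + Attachments.lo A ≤ Attachments.hi A → Theta G
    wide A B gap = WideAttachment.result s s' t s≤L s'≤L t≤L q0~s q0~s' gap q0-none-below q0-none-above qz~t qz-none-below
      where
      open Attachments A renaming (lo to s ; hi to s' ; lo≤L to s≤L ; hi≤L to s'≤L ; x~lo to q0~s ; x~hi to q0~s' ; none-below to q0-none-below ; none-above to q0-none-above)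
      open Attachments B using () renaming (lo to t ; lo≤L to t≤L ; x~lo to qz~t ; none-below to qz-none-below)

    triangle : (A : Attachments q0 i) (B : Attachments qz j) → Attachments.hi A ≡ suc (Attachments.lo A) → Prism G
    triangle A B e = consecutive-neighbours-prism s s' t' e (proj₁ (¬NZ-attachment-inner q0∉NZ i s≤L q0~s)) s'≤L t'≤L q0~s q0~s' q0-none-below q0-none-above qz~t' qz-none-above
      where
      open Attachments A renaming (lo to s ; hi to s' ; lo≤L to s≤L ; hi≤L to s'≤L ; x~lo to q0~s ; x~hi to q0~s' ; none-below to q0-none-below ; none-above to q0-none-above)
      open Attachments B using () renaming (hi to t' ; hi≤L to t'≤L ; x~hi to qz~t' ; none-above to qz-none-above)

    single : (A : Attachments q0 i) (B : Attachments qz j) →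
             Attachments.lo A ≡ Attachments.hi A → Attachments.lo B ≡ Attachments.hi B → Theta G
    single A B e e′ = unique-neighbours-theta s s' t t' e e′ (proj₁ (¬NZ-attachment-inner q0∉NZ i s≤L q0~s)) (proj₁ (¬NZ-attachment-inner qz∉NZ j t≤L qz~t))
                        s≤L t≤L q0~s qz~t q0-none-below q0-none-above qz-none-below qz-none-above
      where
      open Attachments A renaming (lo to s ; hi to s' ; lo≤L to s≤L ; x~lo to q0~s ; none-below to q0-none-below ; none-above to q0-none-above)
      open Attachments B using () renaming (lo to t ; hi to t' ; lo≤L to t≤L ; x~lo to qz~t ; none-below to qz-none-below ; none-above to qz-none-above)

  -- Theta between the apex and q: the three paths P_c[0..tq c]·q.
  module TripleAttachment (q : Vertex) (q-outside : Outside q) (tq : Fin 3 → ℕ) (tq≤L : ∀ c → tq c ≤ L c)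
               (q~tq : ∀ c → q ~ p c (tq c)) (none-below : ∀ c r → r < tq c → ¬ q ~ p c r) where
    legs : Fin 3 → List Vertex
    legs c = segUp-tail c 0 (tq c) ++ [ q ]

    leg-induced : ∀ c → Induced (segUp c 0 (tq c) ++ [ q ])
    leg-induced c = Induced-++ (segUp c 0 (tq c)) [ q ] (segUp-induced c 0 (tq c) (tq≤L c)) tt seam meet
      where
      seam : SeamAdjacent (segUp c 0 (tq c)) [ q ]
      seam lx first = subst (_~ q) (sym (LastOf-unique lx (segUp-last c 0 (tq c)))) (~-sym (q~tq c))
      meet : MeetOnlyAtSeam (segUp c 0 (tq c)) [ q ]
      meet mx (here refl) with segUp-∈ c 0 (tq c) mx
      ... | r , _ , a2 , refl = (λ e → Outside⇒∉P q-outside c (≤-trans a2 (tq≤L c)) (sym e)) ,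
            λ e → LastOf-≡ (segUp-last c 0 (tq c)) (cong (p c) (sym (≤-least⇒≡ (none-below c) a2 (~-sym e)))) , first

    legs-induced : ∀ c → Induced (apex ∷ legs c)
    legs-induced c = subst (λ z → Induced (z ∷ legs c)) (p-apex c) (leg-induced c)

    legs-end : ∀ c → LastOf (apex ∷ legs c) q
    legs-end c = LastOf-∷ (LastOf-++ (segUp-tail c 0 (tq c)) last-[])

    2≤tq : ∀ c → 2 ≤ tq c
    2≤tq c = proj₁ (¬NZ-attachment-inner (proj₁ q-outside) c (tq≤L c) (q~tq c))

    legs-long : ∀ c → 2 ≤ length (legs c)
    legs-long c = ≤-trans (subst (2 ≤_) (sym (segUp-tail-length c 0 (tq c))) (2≤tq c)) (LP.length-++-≤ˡ (segUp-tail c 0 (tq c)))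

    leg-vertex : ∀ c {x} → x ∈ legs c → x ≢ q → ∃ λ r → 1 ≤ r × r ≤ tq c × p c r ≡ x
    leg-vertex c m ne with ∈-++⁻ (segUp-tail c 0 (tq c)) m
    ... | inj₁ m' = segUp-tail-∈ c 0 (tq c) m'
    ... | inj₂ (here e) = ⊥-elim (ne e)

    legs-apart : ∀ c d → c ≢ d → ApartOutside q (legs c) (legs d)
    legs-apart c d cd mx nx my ny with leg-vertex c mx nx | leg-vertex d my ny
    ... | r , a1 , a2 , refl | r' , b1 , b2 , refl =
          p-apart c d cd a1 (≤-trans (s≤s a2) (proj₂ (¬NZ-attachment-inner (proj₁ q-outside) c (tq≤L c) (q~tq c)))) b1 (≤-trans b2 (tq≤L d))

    result : Theta G
    result = theta apex q (λ e → ¬NZ⇒≁apex (proj₁ q-outside) (~-sym e)) legs legs-induced legs-end legs-long legs-apart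

  triple : ∀ x → Outside x → (∀ c → AttachedTo c x) → Theta G
  triple x out attached = TripleAttachment.result x out (lo ∘ A) (lo≤L ∘ A) (x~lo ∘ A) (none-below ∘ A)
    where
    open Attachments
    A : ∀ c → Attachments x c
    A c = attachments x c (attached c)

  module NoConnector (θ-free : ¬ Theta G) (prism-free : ¬ Prism G) where

    no-connector : ∀ {i j k} → i ≢ j → i ≢ k → j ≢ k → Connector i j → ⊥
    no-connector {i} {j} {k} ij ik jk C = by-gaps (gap-cases (Attachments.lo≤hi A)) (gap-cases (Attachments.lo≤hi B))
      where
      open Connector C
      open ConnectorGeometry

      A : Attachments q0 i
      A = attachments q0 i q0-attached

      B : Attachments qz j
      B = attachments qz j qz-attached

      open Attachments A using () renaming (lo to s ; hi to s′)
      open Attachments B using () renaming (lo to t ; hi to t′)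

      by-gaps : (s ≡ s′ ⊎ s′ ≡ suc s ⊎ 2 + s ≤ s′) → (t ≡ t′ ⊎ t′ ≡ suc t ⊎ 2 + t ≤ t′) → ⊥
      by-gaps (inj₂ (inj₂ gap)) _ = θ-free (wide ij ik jk C A B gap)
      by-gaps (inj₂ (inj₁ e)) _ = prism-free (triangle ij ik jk C A B e)
      by-gaps (inj₁ _) (inj₂ (inj₂ gap)) = θ-free (wide (ij ∘ sym) jk ik (reverse-connector C) B A gap)
      by-gaps (inj₁ _) (inj₂ (inj₁ e)) = prism-free (triangle (ij ∘ sym) jk ik (reverse-connector C) B A e)
      by-gaps (inj₁ e) (inj₁ e′) = θ-free (single ij ik jk C A B e e′)

module ConnectingWalks (G : Graph) (S : Pyramid G) where
  open InducedLists G
  open PyramidGeometry G S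
  open AttachmentConfigurations G S

  ConnectingWalk : Fin 3 → Fin 3 → Vertex → List Vertex → Set
  ConnectingWalk i j x xs =
    IsWalk (x ∷ xs) × (∀ {y} → y ∈ (x ∷ xs) → Outside y) × AttachedTo i x × AttachedTo j (lastVertex x xs)

  record ShorterWalk (n : ℕ) : Set where
    constructor shorter
    field
      c d : Fin 3
      c≢d : c ≢ d
      x : Vertex
      xs : List Vertex
      length< : length xs < n
      walk : ConnectingWalk c d x xs

  singleton-walk : ∀ {c d x} → Outside x → AttachedTo c x → AttachedTo d x → ConnectingWalk c d x []
  singleton-walk out ac ad = tt , (λ { (here refl) → out }) , ac , ad

  walk-from : ∀ {i j c x xs y} → y ∈ xs → ConnectingWalk i j x xs → AttachedTo c y →
              ∃ λ vs → length vs < length xs × ConnectingWalk c j y vs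
  walk-from {j = j} {x = x} {y = y} y∈xs (walk , outside , _ , aj) ac with ∈-∃++ y∈xs
  ... | us , vs , refl =
    vs , LP.length-++-≤ʳ (y ∷ vs) {us} , IsWalk-suffix (x ∷ us) y vs walk ,
    (λ m → outside (there (∈-++⁺ʳ us m))) , ac , subst (AttachedTo j) (lastVertex-++ x us y vs) aj

  walk-to : ∀ {i j c x xs y} → y ∈ xs → y ≢ lastVertex x xs → ConnectingWalk i j x xs → AttachedTo c y →
            ∃ λ us → length us < length xs × ConnectingWalk i c x us
  walk-to {x = x} {y = y} y∈xs y≢z _ _ with ∈-∃++ y∈xs
  walk-to {x = x} {y = y} y∈xs y≢z _ _ | us , [] , refl = ⊥-elim (y≢z (sym (lastVertex-++ x us y [])))
  walk-to {c = c} {x = x} {y = y} y∈xs y≢z (walk , outside , ai , _) ac | us , v ∷ vs , refl =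
    us ++ [ y ] , length-prefix< us y v vs , IsWalk-prefix (x ∷ us) y (v ∷ vs) walk ,
    (λ m → outside (∈-prefix x us y (v ∷ vs) m)) , ai , subst (AttachedTo c) (sym (lastVertex-++ x us y [])) ac

  module _ {i j k : Fin 3} (ij : i ≢ j) (ik : i ≢ k) (jk : j ≢ k) (cover : ∀ c → c ≡ i ⊎ c ≡ j ⊎ c ≡ k) where

    induced-walk-reduces : ∀ x xs → 1 ≤ length xs → ConnectingWalk i j x xs → Induced (x ∷ xs) →
                           ShorterWalk (length xs) ⊎ Connector i j
    induced-walk-reduces x xs 1≤∣xs∣ w@(walk , outside , ai , aj) ip
      with any? (AttachedTo? i) xs | AttachedTo? j x | AttachedTo? k x | AttachedTo? k z
         | any? (λ y → (AttachedTo? j y ⊎-dec AttachedTo? k y) ×-dec ¬? (y FP.≟ z)) xs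
      where
      z : Vertex
      z = lastVertex x xs
    ... | yes later-i | _ | _ | _ | _ with find later-i
    ...   | y , y∈xs , ai′ with walk-from y∈xs w ai′
    ...     | vs , lt , w′ = inj₁ (shorter i j ij y vs lt w′)
    induced-walk-reduces x xs 1≤∣xs∣ w@(_ , outside , ai , _) ip | no _ | yes ajx | _ | _ | _ =
      inj₁ (shorter i j ij x [] 1≤∣xs∣ (singleton-walk (outside (here refl)) ai ajx))
    induced-walk-reduces x xs 1≤∣xs∣ w@(_ , outside , ai , _) ip | no _ | no _ | yes akx | _ | _ =
      inj₁ (shorter i k ik x [] 1≤∣xs∣ (singleton-walk (outside (here refl)) ai akx))
    induced-walk-reduces x xs 1≤∣xs∣ w@(_ , outside , _ , aj) ip | no _ | no _ | no _ | yes akz | _ =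
      inj₁ (shorter k j (jk ∘ sym) (lastVertex x xs) [] 1≤∣xs∣
              (singleton-walk (outside (LastOf-∈ (lastVertex-LastOf x xs))) akz aj))
    induced-walk-reduces x xs 1≤∣xs∣ w ip | no _ | no _ | no _ | no _ | yes early with find early
    ... | y , y∈xs , inj₁ ajy , y≢z with walk-to y∈xs y≢z w ajy
    ...   | us , lt , w′ = inj₁ (shorter i j ij x us lt w′)
    induced-walk-reduces x xs 1≤∣xs∣ w ip | no _ | no _ | no _ | no _ | yes early
        | y , y∈xs , inj₂ aky , y≢z with walk-to y∈xs y≢z w aky
    ...   | us , lt , w′ = inj₁ (shorter i k ik x us lt w′)
    induced-walk-reduces x xs 1≤∣xs∣ w@(_ , outside , ai , aj) ip | no ¬later-i | no ¬ajx | no ¬akx | no ¬akz | no ¬early =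
      inj₂ (record { q0 = x ; qs = xs ; qz = lastVertex x xs ; qz-last = lastVertex-LastOf x xs ; Q-induced = ip
                   ; Q-outside = outside ; Q-attachments = only-ends ; q0-attached = ai ; qz-attached = aj })
      where
      only-ends : ∀ {y c r} → y ∈ (x ∷ xs) → r ≤ L c → y ~ p c r → (y ≡ x × c ≡ i) ⊎ (y ≡ lastVertex x xs × c ≡ j)
      only-ends {y} {c} {r} (here refl) r≤L y~p with cover c
      ... | inj₁ c≡i = inj₁ (refl , c≡i)
      ... | inj₂ (inj₁ refl) = ⊥-elim (¬ajx (r , r≤L , y~p))
      ... | inj₂ (inj₂ refl) = ⊥-elim (¬akx (r , r≤L , y~p))
      only-ends {y} {c} {r} (there y∈xs) r≤L y~p with cover c | y FP.≟ lastVertex x xs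
      ... | inj₁ refl | _ = ⊥-elim (¬later-i (lose y∈xs (r , r≤L , y~p)))
      ... | inj₂ (inj₁ refl) | yes y≡z = inj₂ (y≡z , refl)
      ... | inj₂ (inj₁ refl) | no y≢z = ⊥-elim (¬early (lose y∈xs (inj₁ (r , r≤L , y~p) , y≢z)))
      ... | inj₂ (inj₂ refl) | yes refl = ⊥-elim (¬akz (r , r≤L , y~p))
      ... | inj₂ (inj₂ refl) | no y≢z = ⊥-elim (¬early (lose y∈xs (inj₂ (r , r≤L , y~p) , y≢z)))

    walk-reduces : ∀ x xs → ConnectingWalk i j x xs → ShorterWalk (length xs) ⊎ Connector i j ⊎ (∀ c → AttachedTo c x)
    walk-reduces x [] w@(_ , outside , ai , aj) with AttachedTo? k x
    ... | yes ak = inj₂ (inj₂ attached)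
      where
      attached : ∀ c → AttachedTo c x
      attached c with cover c
      ... | inj₁ refl = ai
      ... | inj₂ (inj₁ refl) = aj
      ... | inj₂ (inj₂ refl) = ak
    ... | no ¬ak = inj₂ (inj₁ (record { q0 = x ; qs = [] ; qz = x ; qz-last = last-[] ; Q-induced = tt
                                     ; Q-outside = outside ; Q-attachments = only-x ; q0-attached = ai ; qz-attached = aj }))
      where
      only-x : ∀ {y c r} → y ∈ (x ∷ []) → r ≤ L c → y ~ p c r → (y ≡ x × c ≡ i) ⊎ (y ≡ x × c ≡ j)
      only-x {c = c} (here refl) r≤L y~p with cover c
      ... | inj₁ c≡i = inj₁ (refl , c≡i)
      ... | inj₂ (inj₁ c≡j) = inj₂ (refl , c≡j)
      ... | inj₂ (inj₂ refl) = ⊥-elim (¬ak (_ , r≤L , y~p))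
    walk-reduces x xs@(_ ∷ _) w@(walk , outside , ai , aj) with shortcut-or-induced x xs walk
    ... | inj₂ (xs′ , lt , walk′ , same-end , ⊆xs) =
          inj₁ (shorter i j ij x xs′ lt (walk′ , outside ∘ ⊆xs , ai , subst (AttachedTo j) (sym same-end) aj))
    ... | inj₁ ip with induced-walk-reduces x xs (s≤s z≤n) w ip
    ...   | inj₁ sw = inj₁ sw
    ...   | inj₂ C = inj₂ (inj₁ C)

  module NoConnectingWalk (θ-free : ¬ Theta G) (prism-free : ¬ Prism G) where
    open NoConnector θ-free prism-free

    no-walk-within : ∀ n {i j} → i ≢ j → ∀ x xs → length xs < n → ConnectingWalk i j x xs → ⊥
    no-walk-within (suc n) {i} {j} ij x xs (s≤s ∣xs∣≤n) w with third i j ij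
    ... | k , ik , jk , cover with walk-reduces ij ik jk cover x xs w
    ...   | inj₁ (shorter c d c≢d x′ xs′ lt w′) = no-walk-within n c≢d x′ xs′ (≤-trans lt ∣xs∣≤n) w′
    ...   | inj₂ (inj₁ C) = no-connector ij ik jk C
    ...   | inj₂ (inj₂ attached) = θ-free (triple x (proj₁ (proj₂ w) (here refl)) attached)

    no-connecting-walk : ∀ {i j} → i ≢ j → ∀ x xs → ConnectingWalk i j x xs → ⊥
    no-connecting-walk ij x xs = no-walk-within (suc (length xs)) ij x xs ≤-refl

module ComponentOfPath (G : Graph) (S : Pyramid G) (θ-free : ThetaFree G) (prism-free : PrismFree G)
                       (i : Fin 3) (u : V G) (u∈Pi : _∈P_ G u (Pyramid.P S i)) (u∉NZ : ¬ Pyramid.NZ S u) where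
  open InducedLists G
  open PyramidGeometry G S
  open ConnectingWalks G S
  open NoConnectingWalk θ-free prism-free

  reach : ℕ → Vertex → Set
  reach zero x = x ≡ u
  reach (suc k) y = reach k y ⊎ (¬ NZ y × ∃ λ x → reach k x × x ~ y)

  reach? : ∀ k y → Dec (reach k y)
  reach? zero y = y FP.≟ u
  reach? (suc k) y = reach? k y ⊎-dec (¬? (NZ? y) ×-dec FP.any? (λ x → reach? k x ×-dec adjacent? x y))

  reach⇒¬NZ : ∀ k x → reach k x → ¬ NZ x
  reach⇒¬NZ zero x refl = u∉NZ
  reach⇒¬NZ (suc k) x (inj₁ r) = reach⇒¬NZ k x r
  reach⇒¬NZ (suc k) x (inj₂ (x∉NZ , _)) = x∉NZ

  reach-u : ∀ k → reach k u
  reach-u zero = refl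
  reach-u (suc k) = inj₁ (reach-u k)

  FromPath : Vertex → Set
  FromPath y = (∃ λ r → r ≤ L i × p i r ≡ y) ⊎
               (Outside y × ∃ λ x → ∃ λ xs → IsWalk (x ∷ xs) × (∀ {w} → w ∈ (x ∷ xs) → Outside w) ×
                                              AttachedTo i x × lastVertex x xs ≡ y)

  reach⇒FromPath : ∀ k y → reach k y → FromPath y
  reach⇒FromPath zero y refl = inj₁ (∈P⇒p i u∈Pi)
  reach⇒FromPath (suc k) y (inj₁ r) = reach⇒FromPath k y r
  reach⇒FromPath (suc k) y (inj₂ (y∉NZ , x , rx , x~y)) with reach⇒FromPath k x rx | InΣ? y
  ... | inj₁ (r , r≤L , refl) | no y∉Σ =
        inj₂ ((y∉NZ , y∉Σ) , y , [] , tt , (λ { (here refl) → y∉NZ , y∉Σ }) , (r , r≤L , ~-sym x~y) , refl)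
  ... | inj₁ (r , r≤L , refl) | yes (c , y∈Pc) with ¬NZ-edge-stays-on-path r≤L (reach⇒¬NZ k (p i r) rx) y∉NZ y∈Pc x~y
  ...   | refl = inj₁ (∈P⇒p i y∈Pc)
  reach⇒FromPath (suc k) y (inj₂ (y∉NZ , x , rx , x~y)) | inj₂ (_ , x₀ , xs , walk , outside , att , refl) | yes (c , y∈Pc)
    with c FP.≟ i | ∈P⇒p c y∈Pc
  ... | yes refl | on-Pi = inj₁ on-Pi
  ... | no c≢i | (r , r≤L , refl) = ⊥-elim (no-connecting-walk (c≢i ∘ sym) x₀ xs (walk , outside , att , (r , r≤L , x~y)))
  reach⇒FromPath (suc k) y (inj₂ (y∉NZ , x , rx , x~y)) | inj₂ (_ , x₀ , xs , walk , outside , att , refl) | no y∉Σ =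
    inj₂ ((y∉NZ , y∉Σ) , x₀ , xs ++ [ y ] , IsWalk-snoc x₀ xs y walk x~y , outside′ , att , lastVertex-++ x₀ xs y [])
    where
    outside′ : ∀ {w} → w ∈ (x₀ ∷ xs ++ [ y ]) → Outside w
    outside′ (here e) = outside (here e)
    outside′ (there w∈) with ∈-++⁻ xs w∈
    ... | inj₁ w∈xs = outside (there w∈xs)
    ... | inj₂ (here refl) = y∉NZ , y∉Σ

  reach-stabilises : ∃ λ m → ∀ x → reach (suc m) x → reach m x
  reach-stabilises = iteration-stabilises reach reach? (λ _ _ → inj₁)

  component : Vertex → Set
  component = reach (proj₁ reach-stabilises)

  component-closed : ∀ x y → component x → ¬ NZ y → x ~ y → component y
  component-closed x y cx y∉NZ x~y = proj₂ reach-stabilises y (inj₂ (y∉NZ , x , cx , x~y))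

  component-avoids-other-paths : ∀ {j v} → i ≢ j → _∈P_ G v (Py.P j) → ¬ NZ v → ¬ component v
  component-avoids-other-paths {j} {v} i≢j v∈Pj v∉NZ cv with reach⇒FromPath _ v cv
  ... | inj₁ (r , r≤L , refl) = Py.disj i j i≢j (p i r) (p-∈P i r r≤L) (¬NZ⇒≢apex v∉NZ) v∈Pj
  ... | inj₂ ((_ , v∉Σ) , _) = v∉Σ (j , v∈Pj)

theorem4p1 : (G : Graph) → ThetaFree G → PrismFree G → (S : Pyramid G) →
    (u v : V G) (i j : Fin 3) → i ≢ j →
    _∈P_ G u (Pyramid.P S i) → _∈P_ G v (Pyramid.P S j) →
    ¬ Pyramid.NZ S u → ¬ Pyramid.NZ S v →
    Separates G (Pyramid.NZ S) u v
theorem4p1 G θ-free prism-free S u v i j i≢j u∈Pi v∈Pj u∉NZ v∉NZ =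
  closed-set-separates G NZ component NZ? (reach? _) (reach⇒¬NZ _) component-closed
    (reach-u _) v∉NZ (component-avoids-other-paths i≢j v∈Pj v∉NZ)
  where
  open PyramidGeometry G S using (NZ; NZ?)
  open ComponentOfPath G S θ-free prism-free i u u∈Pi u∉NZ
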